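{- Let $q$ be a prime power, $N\ge 3$, $X$ an $N$-dimensional $\mathbb{F}_q$-space, and let $P \subseteq \mathcal{G}_q(X,1)$ be an arc with $\ell=|P|\ge N$. Then $$\delta_q(X,N-1,P) = \frac{q-1}{q^N-1} \sum_{j=0}^{N-1} (-1)^j \binom{\ell-1}{j} \,q^{N-j-1}.$$
   Context: $\mathcal{G}_q(X,j)$ is the set of $j$-dimensional subspaces of $X$. A point set is a nonempty $P\subseteq\mathcal{G}_q(X,1)$; an arc is a point set in which every $N$ elements span $X$. $V\le X$ distinguishes $P$ if no element of $P$ lies in $V$; $\delta_q(X,k,P)$ is the number of $V\in\mathcal{G}_q(X,k)$ distinguishing $P$ divided by $|\mathcal{G}_q(X,k)|$. -}

module Defs where

open import Level using (0ℓ)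
open import Data.Nat as ℕ using (ℕ; zero; suc; _∸_; _^_)
open import Data.Integer as ℤ using (ℤ; +_)
open import Data.Rational as ℚ using (ℚ)
open import Data.Fin using (Fin; zero; suc)
open import Data.Bool using (Bool; true; false)
open import Data.List using (List; length; lookup)
open import Data.Product using (Σ; ∃; _×_; _,_)
open import Data.Empty using (⊥)
open import Relation.Nullary using (¬_)
open import Relation.Binary.PropositionalEquality using (_≡_; _≢_)
open import Function.Bundles using (_↔_)
open import Algebra.Structures using (IsCommutativeRing)

-- Finite fields: a commutative ring (with propositional equality) in
-- which 0 ≠ 1 and every nonzero element is invertible, together with
-- a bijection Fin q ↔ Carrier (so q = |F|, necessarily a prime power).

record FiniteField : Set₁ where
  field
    Carrier : Set
    _+_ _*_ : Carrier → Carrier → Carrier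
    -_      : Carrier → Carrier
    0# 1#   : Carrier
    isCommutativeRing : IsCommutativeRing _≡_ _+_ _*_ -_ 0# 1#
    0≢1     : 0# ≢ 1#
    inverse : ∀ x → x ≢ 0# → Σ Carrier λ y → x * y ≡ 1#
    q       : ℕ
    enum    : Fin q ↔ Carrier

module Space (F : FiniteField) (N : ℕ) where
  open FiniteField F

  X : Set
  X = Fin N → Carrier

  zeroV : X
  zeroV _ = 0#

  _⊕_ : X → X → X
  (u ⊕ v) i = u i + v i

  _⊙_ : Carrier → X → X
  (c ⊙ v) i = c * v i

  lincomb : (k : ℕ) → (Fin k → Carrier) → (Fin k → X) → X
  lincomb zero    c v = zeroV
  lincomb (suc k) c v = (c zero ⊙ v zero) ⊕ lincomb k (λ i → c (suc i)) (λ i → v (suc i))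

  sumV : (k : ℕ) → (Fin k → X) → X
  sumV zero    y = zeroV
  sumV (suc k) y = y zero ⊕ sumV k (λ i → y (suc i))

  SubsetX : Set
  SubsetX = X → Bool

  _∈_ : X → SubsetX → Set
  x ∈ V = V x ≡ true

  _⊆_ : SubsetX → SubsetX → Set
  U ⊆ V = ∀ x → x ∈ U → x ∈ V

  _≐_ : SubsetX → SubsetX → Set
  U ≐ V = ∀ x → U x ≡ V x

  record IsSubspace (V : SubsetX) : Set where
    field
      zero∈ : zeroV ∈ V
      +∈    : ∀ u v → u ∈ V → v ∈ V → (u ⊕ v) ∈ V
      ·∈    : ∀ c v → v ∈ V → (c ⊙ v) ∈ V

  record IsBasis (V : SubsetX) (k : ℕ) (b : Fin k → X) : Set where
    field
      inV   : ∀ i → b i ∈ V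
      indep : ∀ c → lincomb k c b ≡ zeroV → ∀ i → c i ≡ 0#
      spans : ∀ x → x ∈ V → Σ (Fin k → Carrier) λ c → lincomb k c b ≡ x

  -- V ∈ 𝒢_q(X,k): a subspace of dimension k
  IsSubspaceOfDim : ℕ → SubsetX → Set
  IsSubspaceOfDim k V = IsSubspace V × Σ (Fin k → X) (IsBasis V k)

  record HasCard (S : SubsetX → Set) (m : ℕ) : Set where
    field
      elems    : Fin m → SubsetX
      members  : ∀ i → S (elems i)
      distinct : ∀ i j → elems i ≐ elems j → i ≡ j
      complete : ∀ V → S V → Σ (Fin m) λ i → V ≐ elems i

  record PointSet (ℓ : ℕ) : Set where
    field
      pt       : Fin ℓ → SubsetX
      isPoint  : ∀ i → IsSubspaceOfDim 1 (pt i)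
      distinct : ∀ i j → pt i ≐ pt j → i ≡ j

  -- Arc: every N (distinct) elements of P span X.
  IsArc : ∀ {ℓ} → PointSet ℓ → Set
  IsArc {ℓ} P = ∀ (σ : Fin N → Fin ℓ) → (∀ i j → σ i ≡ σ j → i ≡ j) →
    ∀ x → Σ (Fin N → X) λ y → (∀ i → y i ∈ PointSet.pt P (σ i)) × sumV N y ≡ x

  Distinguishes : ∀ {ℓ} → PointSet ℓ → SubsetX → Set
  Distinguishes P V = ∀ i → ¬ (PointSet.pt P i ⊆ V)

-- a / b as a rational (b = 0 ↦ 0, never used in that case)
_/ℚ_ : ℤ → ℕ → ℚ
a /ℚ zero  = ℚ.0ℚ
a /ℚ suc b = a ℚ./ suc b

Σℤ : ℕ → (ℕ → ℤ) → ℤ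
Σℤ zero    f = + 0
Σℤ (suc n) f = Σℤ n f ℤ.+ f n

sgn : ℕ → ℤ
sgn zero    = + 1
sgn (suc j) = ℤ.- sgn j

-- Hyperplanes of X = F_q^N are the kernels of nonzero functionals x ↦ a·x, and
-- two functionals have the same kernel iff they are proportional.  So every
-- hyperplane arises from exactly q - 1 functionals: n (q - 1) = q^N - 1, and
-- m (q - 1) is the number of functionals vanishing at no point of P.  That number
-- is found by inclusion–exclusion over the points: any N points of an arc are
-- linearly independent, so q^(N - j) functionals vanish at j given points (only
-- the zero functional once j ≥ N), and removing the points one at a time yields
-- the alternating binomial sum.

module Submission where

open import Defs
open import Data.Nat using (ℕ; _≥_; _∸_; _^_)
open import Data.Product using (_×_)
open import Data.Nat.Combinatorics using (_C_)
import Data.Integer as ℤ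
open import Relation.Binary.PropositionalEquality using (_≡_)

open import Level using (0ℓ)
open import Data.Nat as ℕ using (zero; suc; _≤_; _<_; s≤s; z≤n; pred)
import Data.Nat.Properties as ℕP
open import Data.Nat.Combinatorics using (nCk+nC[k+1]≡[n+1]C[k+1])
open import Data.Integer using (ℤ)
import Data.Integer.Properties as ℤP
open import Data.Integer.Tactic.RingSolver using (solve-∀)
import Data.Rational.Properties as ℚP
open import Data.Rational.Unnormalised.Base using (mkℚᵘ; *≡*)
open import Data.Fin as Fin using (Fin; zero; suc; toℕ; _↑ˡ_; _↑ʳ_; combine; punchIn; punchOut)
import Data.Fin.Properties as FinP
open import Data.Fin.Permutation using (permutation)
open import Data.Bool using (Bool; true; false; _∧_; not; if_then_else_)
open import Data.Bool.Properties using (∧-identityʳ; not-injective)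
open import Data.Bool.ListAction using (all)
open import Data.Product using (∃; ∃₂; _,_; proj₁; proj₂; uncurry)
open import Data.List using (List; []; _∷_; length; lookup; _++_; filter; allFin)
open import Data.List.Properties using (length-tabulate)
open import Data.List.Membership.Propositional using () renaming (_∈_ to _∈ₗ_)
open import Data.List.Membership.Propositional.Properties using (∈-lookup; ∈-++⁺ˡ; ∈-++⁺ʳ; ∈-filter⁺; ∈-filter⁻; ∈-allFin)
open import Data.List.Relation.Unary.Any using (here; there; index)
open import Data.List.Relation.Unary.Any.Properties using (lookup-index)
import Data.List.Relation.Unary.All as All
open import Data.List.Relation.Unary.All.Properties using (¬Any⇒All¬)
open import Data.List.Relation.Unary.AllPairs using ([]; _∷_)
open import Data.List.Relation.Unary.Unique.Propositional using (Unique)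
import Data.List.Relation.Unary.Unique.Propositional.Properties as Unique
open import Data.List.Relation.Binary.Disjoint.Propositional using (Disjoint)
import Data.Vec.Functional as Vector
open import Relation.Nullary using (Dec; does; yes; no; contradiction; ¬_)
open import Relation.Nullary.Decidable using (dec-true; dec-false; map′; decidable-stable; ¬?)
open import Relation.Binary.Definitions using (DecidableEquality)
open import Relation.Binary.PropositionalEquality using (refl; sym; trans; cong; cong₂; subst; _≢_; _≗_; module ≡-Reasoning)
open import Function using (_∘_; id)
open import Function.Bundles using (_↔_; Inverse)
open import Function.Definitions using (Injective; Congruent)
open import Algebra.Bundles using (CommutativeRing)
import Algebra.Properties.Semiring.Sum as SemiringSum
import Algebra.Properties.Ring as RingProperties

open SemiringSum ℕP.+-*-semiring using (sum; sum-cong-≗; ∑-comm; ∑-distrib-+; sum-permute; *-distribʳ-sum)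

-- Finite sums and counting

module Counting where
  open import Data.Nat using (_+_; _*_)

  sum-const : ∀ n c → sum {n} (λ _ → c) ≡ n * c
  sum-const zero    c = refl
  sum-const (suc n) c = cong (c +_) (sum-const n c)

  sum-zero : ∀ {n} (f : Fin n → ℕ) → (∀ i → f i ≡ 0) → sum f ≡ 0
  sum-zero {n} f f≡0 = trans (sum-cong-≗ f≡0) (trans (sum-const n 0) (ℕP.*-zeroʳ n))

  sum-↑ : ∀ m n (f : Fin (m + n) → ℕ) → sum f ≡ sum (f ∘ (_↑ˡ n)) + sum (f ∘ (m ↑ʳ_))
  sum-↑ zero    n f = refl
  sum-↑ (suc m) n f = trans (cong (f zero +_) (sum-↑ m n (f ∘ suc))) (sym (ℕP.+-assoc (f zero) _ _))

  sum-combine : ∀ m n (f : Fin (m * n) → ℕ) → sum f ≡ sum {m} (λ i → sum {n} (λ j → f (combine i j)))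
  sum-combine zero    n f = refl
  sum-combine (suc m) n f =
    trans (sum-↑ n (m * n) f) (cong (sum {n} (f ∘ (_↑ˡ m * n)) +_) (sum-combine m n (f ∘ (n ↑ʳ_))))

  𝟙 : Bool → ℕ
  𝟙 true  = 1
  𝟙 false = 0

  count : ∀ {n} → (Fin n → Bool) → ℕ
  count P = sum (𝟙 ∘ P)

  δ : ∀ {n} → Fin n → Fin n → ℕ
  δ i j = 𝟙 (does (i Fin.≟ j))

  sum-δ : ∀ {n} (i : Fin n) → sum (δ i) ≡ 1
  sum-δ {suc n} zero    = cong suc (sum-zero {n} _ (λ _ → refl))
  sum-δ {suc n} (suc i) = sum-δ i

  δ-comm : ∀ {n} (i j : Fin n) → δ i j ≡ δ j i
  δ-comm i j with i Fin.≟ j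
  ... | yes refl = cong 𝟙 (sym (dec-true (i Fin.≟ i) refl))
  ... | no i≢j   = cong 𝟙 (sym (dec-false (j Fin.≟ i) (i≢j ∘ sym)))

  count-injection : ∀ {K M} (P : Fin K → Bool) (g : Fin M → Fin K) → Injective _≡_ _≡_ g →
    (∀ i → P (g i) ≡ true) → (∀ k → P k ≡ true → ∃ λ i → g i ≡ k) → count P ≡ M
  count-injection {M = M} P g g-inj g∈P onto = begin
    sum (𝟙 ∘ P)                           ≡⟨ sum-cong-≗ fibre ⟩
    sum (λ k → sum (λ i → δ (g i) k))     ≡⟨ ∑-comm (λ k i → δ (g i) k) ⟩
    sum (λ i → sum (δ (g i)))             ≡⟨ sum-cong-≗ (sum-δ ∘ g) ⟩
    sum {M} (λ _ → 1)                     ≡⟨ sum-const M 1 ⟩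
    M * 1                                 ≡⟨ ℕP.*-identityʳ M ⟩
    M                                     ∎
    where
    open ≡-Reasoning
    fibre : ∀ k → 𝟙 (P k) ≡ sum (λ i → δ (g i) k)
    fibre k with P k in Pk
    ... | false = sym (sum-zero _ λ i → cong 𝟙 (dec-false (g i Fin.≟ k) λ gi≡k →
                    contradiction (trans (sym Pk) (trans (cong P (sym gi≡k)) (g∈P i))) λ ()))
    ... | true with onto k Pk
    ...   | i₀ , refl = sym (trans (sum-cong-≗ λ i → δ-injective i) (trans (sum-cong-≗ (λ i → δ-comm i i₀)) (sum-δ i₀)))
      where
      δ-injective : ∀ i → δ (g i) (g i₀) ≡ δ i i₀
      δ-injective i with i Fin.≟ i₀
      ... | yes refl = cong 𝟙 (dec-true (g i Fin.≟ g i) refl)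
      ... | no i≢i₀  = cong 𝟙 (dec-false (g i Fin.≟ g i₀) (i≢i₀ ∘ g-inj))

  injective⇒surjective : ∀ {n} {f : Fin n → Fin n} → Injective _≡_ _≡_ f → ∀ y → ∃ λ x → f x ≡ y
  injective⇒surjective {n} {f} f-inj y with FinP.any? (λ x → f x Fin.≟ y)
  ... | yes hit = hit
  injective⇒surjective {suc n} {f} f-inj y | no miss =
    contradiction (FinP.injective⇒≤ g-inj) (ℕP.<-irrefl refl)
    where
    g : Fin (suc n) → Fin n
    g x = punchOut {i = y} {j = f x} (λ y≡fx → miss (x , sym y≡fx))
    g-inj : Injective _≡_ _≡_ g
    g-inj {x} {x′} = f-inj ∘ FinP.punchOut-injective {i = y} {j = f x} {k = f x′} _ _

  surjective⇒injective : ∀ {n} {f : Fin n → Fin n} → (∀ y → ∃ λ x → f x ≡ y) → Injective _≡_ _≡_ f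
  surjective⇒injective {n} {f} f-surj {x} {x′} fx≡fx′ =
    trans (sym (g∘f≗id x)) (trans (cong g fx≡fx′) (g∘f≗id x′))
    where
    g : Fin n → Fin n
    g y = proj₁ (f-surj y)
    f∘g≗id : ∀ y → f (g y) ≡ y
    f∘g≗id y = proj₂ (f-surj y)
    g-surj : ∀ x → ∃ λ y → g y ≡ x
    g-surj = injective⇒surjective λ {y} {y′} gy≡gy′ → trans (sym (f∘g≗id y)) (trans (cong f gy≡gy′) (f∘g≗id y′))
    g∘f≗id : ∀ x → g (f x) ≡ x
    g∘f≗id x with y , refl ← g-surj x = cong g (f∘g≗id y)

  count-∘-injective : ∀ {K} (P : Fin K → Bool) {π : Fin K → Fin K} → Injective _≡_ _≡_ π → count (P ∘ π) ≡ count P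
  count-∘-injective P {π} π-inj = sym (sum-permute (𝟙 ∘ P) (permutation π π⁻ π-π⁻ π⁻-π))
    where
    π⁻ : _
    π⁻ y = proj₁ (injective⇒surjective π-inj y)
    π-π⁻ : ∀ y → π (π⁻ y) ≡ y
    π-π⁻ y = proj₂ (injective⇒surjective π-inj y)
    π⁻-π : ∀ x → π⁻ (π x) ≡ x
    π⁻-π x = π-inj (π-π⁻ (π x))

  count-const-true : ∀ n → count {n} (λ _ → true) ≡ n
  count-const-true n = trans (sum-const n 1) (ℕP.*-identityʳ n)

  count-∧ : ∀ {n} b (P : Fin n → Bool) → count (λ i → b ∧ P i) ≡ 𝟙 b * count P
  count-∧ true  P = sym (ℕP.+-identityʳ _)
  count-∧ {n} false P = sum-zero {n} _ (λ _ → refl)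

  count-not : ∀ {n} (P : Fin n → Bool) → count P + count (not ∘ P) ≡ n
  count-not {n} P =
    trans (sym (∑-distrib-+ (𝟙 ∘ P) (𝟙 ∘ not ∘ P))) (trans (sum-cong-≗ (λ i → 𝟙-not (P i))) (count-const-true n))
    where
    𝟙-not : ∀ b → 𝟙 b + 𝟙 (not b) ≡ 1
    𝟙-not true  = refl
    𝟙-not false = refl

  count-+ : ∀ {n} {P R S : Fin n → Bool} → (∀ i → 𝟙 (P i) ≡ 𝟙 (R i) + 𝟙 (S i)) → count P ≡ count R + count S
  count-+ {R = R} {S} split = trans (sum-cong-≗ split) (∑-distrib-+ (𝟙 ∘ R) (𝟙 ∘ S))

open Counting

distinct⇒1≤ : ∀ {m} (a b : Fin (suc m)) → a ≢ b → 1 ≤ m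
distinct⇒1≤ {zero}  zero zero a≢b = contradiction refl a≢b
distinct⇒1≤ {suc m} _    _    _   = s≤s z≤n

Fin-inhabited⇒suc : ∀ {n} → Fin n → ∃ λ m → n ≡ suc m
Fin-inhabited⇒suc {suc m} _ = m , refl

does-true : ∀ {A : Set} (d : Dec A) → does d ≡ true → A
does-true (yes a) _ = a

does-false : ∀ {A : Set} (d : Dec A) → does d ≡ false → ¬ A
does-false (no ¬a) _ = ¬a

≡true-⇔⇒≡ : ∀ {b₁ b₂} → (b₁ ≡ true → b₂ ≡ true) → (b₂ ≡ true → b₁ ≡ true) → b₁ ≡ b₂
≡true-⇔⇒≡ {true}  {b₂}    ⇒ ⇐ = sym (⇒ refl)
≡true-⇔⇒≡ {false} {true}  ⇒ ⇐ = ⇐ refl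
≡true-⇔⇒≡ {false} {false} ⇒ ⇐ = refl

all-∈ : ∀ {A : Set} (f : A → Bool) {xs x} → all f xs ≡ true → x ∈ₗ xs → f x ≡ true
all-∈ f {y ∷ ys} h x∈ with f y in fy
all-∈ f {y ∷ ys} h (here refl) | true = fy
all-∈ f {y ∷ ys} h (there x∈) | true = all-∈ f h x∈

∈-all : ∀ {A : Set} (f : A → Bool) xs → (∀ {x} → x ∈ₗ xs → f x ≡ true) → all f xs ≡ true
∈-all f []       f≡true = refl
∈-all f (x ∷ xs) f≡true rewrite f≡true (here refl) = ∈-all f xs (f≡true ∘ there)

covering⇒≤length : ∀ {n} (xs : List (Fin n)) → (∀ k → k ∈ₗ xs) → n ≤ length xs
covering⇒≤length xs covers = FinP.injective⇒≤ {f = index ∘ covers} λ {k} {k′} eq →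
  trans (lookup-index (covers k)) (trans (cong (lookup xs) eq) (sym (lookup-index (covers k′))))

lookup-injective : ∀ {A : Set} {xs : List A} → Unique xs → Injective _≡_ _≡_ (lookup xs)
lookup-injective {xs = x ∷ xs} (x∉xs ∷ u) {zero}  {zero}  eq = refl
lookup-injective {xs = x ∷ xs} (x∉xs ∷ u) {zero}  {suc j} eq = contradiction eq (All.lookup x∉xs (∈-lookup j))
lookup-injective {xs = x ∷ xs} (x∉xs ∷ u) {suc i} {zero}  eq = contradiction (sym eq) (All.lookup x∉xs (∈-lookup i))
lookup-injective {xs = x ∷ xs} (x∉xs ∷ u) {suc i} {suc j} eq = cong suc (lookup-injective u eq)

lookup-++-∈ : ∀ {A : Set} (xs : List A) {ys} (j : Fin (length (xs ++ ys))) → toℕ j < length xs → lookup (xs ++ ys) j ∈ₗ xs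
lookup-++-∈ (x ∷ xs) zero    _         = here refl
lookup-++-∈ (x ∷ xs) (suc j) (s≤s j<n) = there (lookup-++-∈ xs j j<n)

lookup-++-index : ∀ {A : Set} {xs ys : List A} {x} (x∈xs : x ∈ₗ xs) (j : Fin (length (xs ++ ys))) →
  toℕ j ≡ toℕ (index x∈xs) → lookup (xs ++ ys) j ≡ x
lookup-++-index (here refl) zero    _  = refl
lookup-++-index (there x∈)  (suc j) eq = lookup-++-index x∈ j (ℕP.suc-injective eq)

-- The alternating binomial sum

m≡[m+n]-n : ∀ (m n : ℤ) → m ≡ (m ℤ.+ n) ℤ.- n
m≡[m+n]-n = solve-∀

-- The number of functionals on F_Q^N vanishing at j given points of an arc and at
-- none of t further points.
vanishAvoidCount : (Q N : ℕ) → ℕ → ℕ → ℤ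
vanishAvoidCount Q N j zero    = ℤ.+ (Q ^ (N ∸ j))
vanishAvoidCount Q N j (suc t) = vanishAvoidCount Q N j t ℤ.- vanishAvoidCount Q N (suc j) t

module Alternating (q′ : ℕ) where
  Q : ℕ
  Q = suc q′

  horner : ℕ → ℕ → ℤ
  horner zero    t = ℤ.+ 0
  horner (suc D) t = ℤ.+ Q ℤ.* horner D t ℤ.+ sgn D ℤ.* ℤ.+ (t C D)

  horner-1 : ∀ t → horner 1 t ≡ ℤ.+ 1
  horner-1 t = cong (ℤ._+ ℤ.+ 1) (ℤP.*-zeroʳ (ℤ.+ Q))

  horner-0 : ∀ D → horner (suc D) 0 ≡ ℤ.+ (Q ^ D)
  horner-0 zero    = horner-1 0
  horner-0 (suc D) = begin
    ℤ.+ Q ℤ.* horner (suc D) 0 ℤ.+ sgn (suc D) ℤ.* ℤ.+ 0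
      ≡⟨ cong₂ ℤ._+_ (cong (ℤ.+ Q ℤ.*_) (horner-0 D)) (ℤP.*-zeroʳ (sgn (suc D))) ⟩
    ℤ.+ Q ℤ.* ℤ.+ (Q ^ D) ℤ.+ ℤ.+ 0                       ≡⟨ ℤP.+-identityʳ _ ⟩
    ℤ.+ Q ℤ.* ℤ.+ (Q ^ D)                                 ≡⟨ sym (ℤP.pos-* Q (Q ^ D)) ⟩
    ℤ.+ (Q ^ suc D)                                       ∎
    where open ≡-Reasoning

  horner-Pascal : ∀ D t → horner D (suc t) ≡ horner D t ℤ.- horner (pred D) t
  horner-Pascal zero          t = refl
  horner-Pascal (suc zero)    t = trans (horner-1 (suc t)) (cong (ℤ._- ℤ.+ 0) (sym (horner-1 t)))
  horner-Pascal (suc (suc D)) t = begin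
    ℤ.+ Q ℤ.* horner (suc D) (suc t) ℤ.+ sgn (suc D) ℤ.* ℤ.+ (suc t C suc D)
      ≡⟨ cong₂ (λ h c → ℤ.+ Q ℤ.* h ℤ.+ sgn (suc D) ℤ.* c) (horner-Pascal (suc D) t)
           (trans (cong ℤ.+_ (sym (nCk+nC[k+1]≡[n+1]C[k+1] t D))) (ℤP.pos-+ (t C D) (t C suc D))) ⟩
    ℤ.+ Q ℤ.* (horner (suc D) t ℤ.- horner D t) ℤ.+ ℤ.- sgn D ℤ.* (ℤ.+ (t C D) ℤ.+ ℤ.+ (t C suc D))
      ≡⟨ regroup (ℤ.+ Q) (horner (suc D) t) (horner D t) (sgn D) (ℤ.+ (t C D)) (ℤ.+ (t C suc D)) ⟩
    horner (suc (suc D)) t ℤ.- horner (suc D) t ∎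
    where
    open ≡-Reasoning
    regroup : ∀ (q a b s x y : ℤ) →
      q ℤ.* (a ℤ.- b) ℤ.+ ℤ.- s ℤ.* (x ℤ.+ y) ≡ (q ℤ.* a ℤ.+ ℤ.- s ℤ.* y) ℤ.- (q ℤ.* b ℤ.+ s ℤ.* x)
    regroup = solve-∀

  horner-first-difference : ∀ N j → ℤ.+ (Q ^ (N ∸ j)) ℤ.- ℤ.+ (Q ^ (N ∸ suc j)) ≡ ℤ.+ q′ ℤ.* horner (N ∸ j) 0
  horner-first-difference zero    zero    = sym (ℤP.*-zeroʳ (ℤ.+ q′))
  horner-first-difference zero    (suc j) = sym (ℤP.*-zeroʳ (ℤ.+ q′))
  horner-first-difference (suc N) zero    = begin
    ℤ.+ (Q ^ suc N) ℤ.- ℤ.+ (Q ^ N)                   ≡⟨ cong (ℤ._- ℤ.+ (Q ^ N)) (ℤP.pos-+ (Q ^ N) (q′ ℕ.* Q ^ N)) ⟩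
    ℤ.+ (Q ^ N) ℤ.+ ℤ.+ (q′ ℕ.* Q ^ N) ℤ.- ℤ.+ (Q ^ N) ≡⟨ cancel (ℤ.+ (Q ^ N)) _ ⟩
    ℤ.+ (q′ ℕ.* Q ^ N)                                ≡⟨ ℤP.pos-* q′ _ ⟩
    ℤ.+ q′ ℤ.* ℤ.+ (Q ^ N)                            ≡⟨ cong (ℤ.+ q′ ℤ.*_) (sym (horner-0 N)) ⟩
    ℤ.+ q′ ℤ.* horner (suc N) 0                       ∎
    where
    open ≡-Reasoning
    cancel : ∀ (a b : ℤ) → a ℤ.+ b ℤ.- a ≡ b
    cancel = solve-∀
  horner-first-difference (suc N) (suc j) = horner-first-difference N j

  vanishAvoidCount-suc : ∀ N t j → vanishAvoidCount Q N j (suc t) ≡ ℤ.+ q′ ℤ.* horner (N ∸ j) t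
  vanishAvoidCount-suc N zero    j = horner-first-difference N j
  vanishAvoidCount-suc N (suc t) j = begin
    vanishAvoidCount Q N j (suc t) ℤ.- vanishAvoidCount Q N (suc j) (suc t)
      ≡⟨ cong₂ ℤ._-_ (vanishAvoidCount-suc N t j) (vanishAvoidCount-suc N t (suc j)) ⟩
    ℤ.+ q′ ℤ.* horner (N ∸ j) t ℤ.- ℤ.+ q′ ℤ.* horner (N ∸ suc j) t
      ≡⟨ cong (λ d → ℤ.+ q′ ℤ.* horner (N ∸ j) t ℤ.- ℤ.+ q′ ℤ.* horner d t) (sym (ℕP.pred[m∸n]≡m∸[1+n] N j)) ⟩
    ℤ.+ q′ ℤ.* horner (N ∸ j) t ℤ.- ℤ.+ q′ ℤ.* horner (pred (N ∸ j)) t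
      ≡⟨ factor (ℤ.+ q′) _ _ ⟩
    ℤ.+ q′ ℤ.* (horner (N ∸ j) t ℤ.- horner (pred (N ∸ j)) t)
      ≡⟨ cong (ℤ.+ q′ ℤ.*_) (sym (horner-Pascal (N ∸ j) t)) ⟩
    ℤ.+ q′ ℤ.* horner (N ∸ j) (suc t) ∎
    where
    open ≡-Reasoning
    factor : ∀ (c a b : ℤ) → c ℤ.* a ℤ.- c ℤ.* b ≡ c ℤ.* (a ℤ.- b)
    factor = solve-∀

  alternatingTerm : ℕ → ℕ → ℕ → ℤ
  alternatingTerm D t i = sgn i ℤ.* ℤ.+ (t C i) ℤ.* ℤ.+ (Q ^ (D ∸ i ∸ 1))

  Σℤ-cong : ∀ D {f g : ℕ → ℤ} → (∀ i → i < D → f i ≡ g i) → Σℤ D f ≡ Σℤ D g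
  Σℤ-cong zero    f≡g = refl
  Σℤ-cong (suc D) f≡g = cong₂ ℤ._+_ (Σℤ-cong D (λ i i<D → f≡g i (ℕP.m<n⇒m<1+n i<D))) (f≡g D (ℕP.n<1+n D))

  Σℤ-*ˡ : ∀ D c (f : ℕ → ℤ) → Σℤ D (λ i → c ℤ.* f i) ≡ c ℤ.* Σℤ D f
  Σℤ-*ˡ zero    c f = sym (ℤP.*-zeroʳ c)
  Σℤ-*ˡ (suc D) c f = trans (cong (ℤ._+ (c ℤ.* f D)) (Σℤ-*ˡ D c f)) (sym (ℤP.*-distribˡ-+ c (Σℤ D f) (f D)))

  Q*alternatingTerm : ∀ D t i → i < D → ℤ.+ Q ℤ.* alternatingTerm D t i ≡ alternatingTerm (suc D) t i
  Q*alternatingTerm D t i i<D = begin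
    ℤ.+ Q ℤ.* (s ℤ.* c ℤ.* ℤ.+ (Q ^ (D ∸ i ∸ 1)))   ≡⟨ swap (ℤ.+ Q) s c _ ⟩
    s ℤ.* c ℤ.* (ℤ.+ Q ℤ.* ℤ.+ (Q ^ (D ∸ i ∸ 1)))   ≡⟨ cong (s ℤ.* c ℤ.*_) (sym (ℤP.pos-* Q _)) ⟩
    s ℤ.* c ℤ.* ℤ.+ (Q ^ suc (D ∸ i ∸ 1))           ≡⟨ cong (λ e → s ℤ.* c ℤ.* ℤ.+ (Q ^ e)) (sym (exponent D i i<D)) ⟩
    s ℤ.* c ℤ.* ℤ.+ (Q ^ (suc D ∸ i ∸ 1))           ∎
    where
    open ≡-Reasoning
    s = sgn i
    c = ℤ.+ (t C i)
    swap : ∀ (q s c p : ℤ) → q ℤ.* (s ℤ.* c ℤ.* p) ≡ s ℤ.* c ℤ.* (q ℤ.* p)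
    swap = solve-∀
    exponent : ∀ D i → i < D → suc D ∸ i ∸ 1 ≡ suc (D ∸ i ∸ 1)
    exponent (suc D) zero    _         = refl
    exponent (suc D) (suc i) (s≤s i<D) = exponent D i i<D

  horner≡Σ : ∀ D t → horner D t ≡ Σℤ D (alternatingTerm D t)
  horner≡Σ zero    t = refl
  horner≡Σ (suc D) t = begin
    ℤ.+ Q ℤ.* horner D t ℤ.+ sgn D ℤ.* ℤ.+ (t C D)
      ≡⟨ cong₂ ℤ._+_ (cong (ℤ.+ Q ℤ.*_) (horner≡Σ D t)) last ⟩
    ℤ.+ Q ℤ.* Σℤ D (alternatingTerm D t) ℤ.+ alternatingTerm (suc D) t D
      ≡⟨ cong (ℤ._+ alternatingTerm (suc D) t D) (sym (Σℤ-*ˡ D (ℤ.+ Q) (alternatingTerm D t))) ⟩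
    Σℤ D (λ i → ℤ.+ Q ℤ.* alternatingTerm D t i) ℤ.+ alternatingTerm (suc D) t D
      ≡⟨ cong (ℤ._+ alternatingTerm (suc D) t D) (Σℤ-cong D (Q*alternatingTerm D t)) ⟩
    Σℤ D (alternatingTerm (suc D) t) ℤ.+ alternatingTerm (suc D) t D
      ∎
    where
    open ≡-Reasoning
    last : sgn D ℤ.* ℤ.+ (t C D) ≡ alternatingTerm (suc D) t D
    last = trans (sym (ℤP.*-identityʳ _)) (cong (λ e → sgn D ℤ.* ℤ.+ (t C D) ℤ.* ℤ.+ (Q ^ e)) (sym (top D)))
      where
      top : ∀ D → suc D ∸ D ∸ 1 ≡ 0
      top zero    = refl
      top (suc D) = top D

  vanishAvoidCount-closed : ∀ N t → vanishAvoidCount Q N 0 (suc t) ≡ ℤ.+ q′ ℤ.* Σℤ N (alternatingTerm N t)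
  vanishAvoidCount-closed N t = trans (vanishAvoidCount-suc N t 0) (cong (ℤ.+ q′ ℤ.*_) (horner≡Σ N t))

/ℚ-cancel : ∀ m n d c (E : ℤ) → 1 ≤ d → n ℕ.* c ≡ d → ℤ.+ (m ℕ.* c) ≡ ℤ.+ c ℤ.* E → (ℤ.+ m) /ℚ n ≡ (ℤ.+ c ℤ.* E) /ℚ d
/ℚ-cancel m zero    (suc d) c E _ () _
/ℚ-cancel m (suc n) (suc d) c E _ nc≡d mc≡cE =
  ℚP.fromℚᵘ-cong {mkℚᵘ (ℤ.+ m) n} {mkℚᵘ (ℤ.+ c ℤ.* E) d} (*≡* (begin
    ℤ.+ m ℤ.* ℤ.+ suc d                  ≡⟨ cong (λ x → ℤ.+ m ℤ.* ℤ.+ x) (sym nc≡d) ⟩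
    ℤ.+ m ℤ.* ℤ.+ (suc n ℕ.* c)          ≡⟨ cong (ℤ.+ m ℤ.*_) (ℤP.pos-* (suc n) c) ⟩
    ℤ.+ m ℤ.* (ℤ.+ suc n ℤ.* ℤ.+ c)      ≡⟨ rearrange (ℤ.+ m) (ℤ.+ suc n) (ℤ.+ c) ⟩
    ℤ.+ m ℤ.* ℤ.+ c ℤ.* ℤ.+ suc n        ≡⟨ cong (ℤ._* ℤ.+ suc n) (trans (sym (ℤP.pos-* m c)) mc≡cE) ⟩
    ℤ.+ c ℤ.* E ℤ.* ℤ.+ suc n            ∎))
  where
  open ≡-Reasoning
  rearrange : ∀ (m n c : ℤ) → m ℤ.* (n ℤ.* c) ≡ m ℤ.* c ℤ.* n
  rearrange = solve-∀

-- Linear algebra and counting over a finite field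

module FieldCounting (F : FiniteField) {q′ : ℕ} (q≡1+q′ : FiniteField.q F ≡ suc q′) where
  open FiniteField F using (Carrier; isCommutativeRing; 0≢1; inverse; enum)

  commutativeRing : CommutativeRing 0ℓ 0ℓ
  commutativeRing = record { isCommutativeRing = isCommutativeRing }

  open CommutativeRing commutativeRing
    using (_+_; _*_; -_; _-_; 0#; 1#; +-identityˡ; +-identityʳ; -‿inverseʳ; *-assoc; *-comm;
           *-identityˡ; *-identityʳ; distribˡ; zeroˡ; zeroʳ)
  open RingProperties (CommutativeRing.ring commutativeRing)
    using (-‿distribˡ-*; -‿distribʳ-*; -‿involutive; -0#≈0#; -‿+-comm; +-inverseˡ-unique; +-inverseʳ-unique;
           x∙y⁻¹≈ε⇒x≈y; [y-z]x≈yx-zx)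
  open SemiringSum (CommutativeRing.semiring commutativeRing)
    using () renaming (sum to ∑; sum-cong-≗ to ∑-cong; ∑-distrib-+ to ∑-distrib-+ᶠ; *-distribˡ-sum to *-distribˡ-∑;
              *-distribʳ-sum to *-distribʳ-∑; sum-remove to ∑-remove; sum-replicate-zero to ∑-zero)

  Q : ℕ
  Q = suc q′

  elements : Fin Q ↔ Carrier
  elements = subst (λ k → Fin k ↔ Carrier) q≡1+q′ enum

  toF : Fin Q → Carrier
  toF = Inverse.to elements

  fromF : Carrier → Fin Q
  fromF = Inverse.from elements

  toF-fromF : ∀ x → toF (fromF x) ≡ x
  toF-fromF = Inverse.strictlyInverseˡ elements

  fromF-toF : ∀ i → fromF (toF i) ≡ i
  fromF-toF = Inverse.strictlyInverseʳ elements

  fromF-injective : Injective _≡_ _≡_ fromF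
  fromF-injective {x} {y} eq = trans (sym (toF-fromF x)) (trans (cong toF eq) (toF-fromF y))

  _≟_ : DecidableEquality Carrier
  x ≟ y = map′ fromF-injective (cong fromF) (fromF x Fin.≟ fromF y)

  isZero : Carrier → Bool
  isZero x = does (x ≟ 0#)

  isZero-≡0 : ∀ {x} → isZero x ≡ true → x ≡ 0#
  isZero-≡0 {x} = does-true (x ≟ 0#)

  ≡0⇒isZero : ∀ {x} → x ≡ 0# → isZero x ≡ true
  ≡0⇒isZero {x} = dec-true (x ≟ 0#)

  isZero-≢0 : ∀ {x} → isZero x ≡ false → x ≢ 0#
  isZero-≢0 {x} = does-false (x ≟ 0#)

  ≢0⇒isZero : ∀ {x} → x ≢ 0# → isZero x ≡ false
  ≢0⇒isZero {x} = dec-false (x ≟ 0#)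

  1≤q′ : 1 ≤ q′
  1≤q′ = distinct⇒1≤ (fromF 0#) (fromF 1#) (0≢1 ∘ fromF-injective)

  inv : (x : Carrier) → x ≢ 0# → Carrier
  inv x x≢0 = proj₁ (inverse x x≢0)

  *-inverseʳ : ∀ x (x≢0 : x ≢ 0#) → x * inv x x≢0 ≡ 1#
  *-inverseʳ x x≢0 = proj₂ (inverse x x≢0)

  *-inverseˡ : ∀ x (x≢0 : x ≢ 0#) → inv x x≢0 * x ≡ 1#
  *-inverseˡ x x≢0 = trans (*-comm _ x) (*-inverseʳ x x≢0)

  *-cancelˡ : ∀ c {x y} → c ≢ 0# → c * x ≡ c * y → x ≡ y
  *-cancelˡ c {x} {y} c≢0 cx≡cy = begin
    x                  ≡⟨ sym (*-identityˡ x) ⟩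
    1# * x             ≡⟨ cong (_* x) (sym (*-inverseˡ c c≢0)) ⟩
    (inv c c≢0 * c) * x ≡⟨ *-assoc _ c x ⟩
    inv c c≢0 * (c * x) ≡⟨ cong (inv c c≢0 *_) cx≡cy ⟩
    inv c c≢0 * (c * y) ≡⟨ sym (*-assoc _ c y) ⟩
    (inv c c≢0 * c) * y ≡⟨ cong (_* y) (*-inverseˡ c c≢0) ⟩
    1# * y             ≡⟨ *-identityˡ y ⟩
    y                  ∎
    where open ≡-Reasoning

  *-solveˡ : ∀ c {y z} (c≢0 : c ≢ 0#) → c * y ≡ z → y ≡ inv c c≢0 * z
  *-solveˡ c {y} c≢0 cy≡z = *-cancelˡ c c≢0 (trans cy≡z (sym (trans (sym (*-assoc c _ _))
    (trans (cong (_* _) (*-inverseʳ c c≢0)) (*-identityˡ _)))))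

  *-≢0 : ∀ {x y} → x ≢ 0# → y ≢ 0# → x * y ≢ 0#
  *-≢0 {x} {y} x≢0 y≢0 xy≡0 = y≢0 (*-cancelˡ x x≢0 (trans xy≡0 (sym (zeroʳ x))))

  unit : Fin q′ → Carrier
  unit i = toF (punchIn (fromF 0#) i)

  unit≢0 : ∀ i → unit i ≢ 0#
  unit≢0 i unit≡0 = FinP.punchInᵢ≢i (fromF 0#) i (trans (sym (fromF-toF _)) (cong fromF unit≡0))

  unit-injective : Injective _≡_ _≡_ unit
  unit-injective eq = FinP.punchIn-injective (fromF 0#) _ _
    (trans (sym (fromF-toF _)) (trans (cong fromF eq) (fromF-toF _)))

  unit-surjective : ∀ y → y ≢ 0# → ∃ λ i → unit i ≡ y
  unit-surjective y y≢0 =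
    punchOut 0≢y , trans (cong toF (FinP.punchIn-punchOut 0≢y)) (toF-fromF y)
    where
    0≢y : fromF 0# ≢ fromF y
    0≢y = y≢0 ∘ sym ∘ fromF-injective

  -- F^n is enumerated as Fin (Q ^ n) by base-Q digits.  Without function
  -- extensionality vectors are compared by _≗_, which predicates and maps must respect.
  encode : ∀ {n} → (Fin n → Carrier) → Fin (Q ^ n)
  encode x = Fin.funToFin (fromF ∘ x)

  decode : ∀ n → Fin (Q ^ n) → (Fin n → Carrier)
  decode n k = toF ∘ Fin.finToFun k

  decode-encode : ∀ {n} (x : Fin n → Carrier) → decode n (encode x) ≗ x
  decode-encode x i = trans (cong toF (FinP.finToFun-funToFin (fromF ∘ x) i)) (toF-fromF (x i))

  encode-cong : ∀ {n} → Congruent _≗_ _≡_ (encode {n})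
  encode-cong {zero}  x≗y = refl
  encode-cong {suc n} x≗y = cong₂ combine (cong fromF (x≗y zero)) (encode-cong (x≗y ∘ suc))

  encode-decode : ∀ n (k : Fin (Q ^ n)) → encode (decode n k) ≡ k
  encode-decode n k = trans (funToFin-cong {n} (fromF-toF ∘ Fin.finToFun k)) (FinP.funToFin-finToFin {n} {Q} k)
    where
    funToFin-cong : ∀ {m} {f g : Fin m → Fin Q} → f ≗ g → Fin.funToFin f ≡ Fin.funToFin g
    funToFin-cong {zero}  f≗g = refl
    funToFin-cong {suc m} f≗g = cong₂ combine (f≗g zero) (funToFin-cong (f≗g ∘ suc))

  encode-injective : ∀ {n} → Injective _≗_ _≡_ (encode {n})
  encode-injective {n} {x} {y} eq i = trans (sym (decode-encode x i)) (trans (cong (λ k → decode n k i) eq) (decode-encode y i))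

  onCodes : ∀ {m n} → ((Fin m → Carrier) → (Fin n → Carrier)) → Fin (Q ^ m) → Fin (Q ^ n)
  onCodes {m} Φ = encode ∘ Φ ∘ decode m

  onCodes-injective : ∀ {n} {Φ : (Fin n → Carrier) → (Fin n → Carrier)} →
    Congruent _≗_ _≗_ Φ → Injective _≗_ _≗_ Φ → Injective _≡_ _≡_ (onCodes Φ)
  onCodes-injective {n} Φ-cong Φ-inj {k} {k′} eq =
    trans (sym (encode-decode n k)) (trans (encode-cong (Φ-inj (encode-injective eq))) (encode-decode n k′))

  countV : ∀ n → ((Fin n → Carrier) → Bool) → ℕ
  countV n R = count (R ∘ decode n)

  countV-injection : ∀ {n M} (R : (Fin n → Carrier) → Bool) → Congruent _≗_ _≡_ R →
    (g : Fin M → (Fin n → Carrier)) → (∀ {i j} → g i ≗ g j → i ≡ j) → (∀ i → R (g i) ≡ true) →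
    (∀ x → R x ≡ true → ∃ λ i → g i ≗ x) → countV n R ≡ M
  countV-injection {n} R R-cong g g-inj g∈R onto =
    count-injection (R ∘ decode n) (encode ∘ g) (g-inj ∘ encode-injective)
      (λ i → trans (R-cong (decode-encode (g i))) (g∈R i))
      (λ k Rk → let (i , gi≗x) = onto (decode n k) Rk in i , trans (encode-cong gi≗x) (encode-decode n k))

  countV-∘-injective : ∀ {n} (R : (Fin n → Carrier) → Bool) → Congruent _≗_ _≡_ R →
    {Φ : (Fin n → Carrier) → (Fin n → Carrier)} → Congruent _≗_ _≗_ Φ → Injective _≗_ _≗_ Φ →
    countV n (R ∘ Φ) ≡ countV n R
  countV-∘-injective {n} R R-cong {Φ} Φ-cong Φ-inj =
    trans (sum-cong-≗ (λ k → cong 𝟙 (sym (R-cong (decode-encode (Φ (decode n k)))))))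
          (count-∘-injective (R ∘ decode n) (onCodes-injective Φ-cong Φ-inj))

  injective⇒surjectiveᵛ : ∀ {n} {Φ : (Fin n → Carrier) → (Fin n → Carrier)} →
    Congruent _≗_ _≗_ Φ → Injective _≗_ _≗_ Φ → ∀ y → ∃ λ x → Φ x ≗ y
  injective⇒surjectiveᵛ {n} Φ-cong Φ-inj y
    with k , eq ← injective⇒surjective (onCodes-injective Φ-cong Φ-inj) (encode y) =
    decode n k , λ i → trans (sym (decode-encode _ i)) (trans (cong (λ k → decode n k i) eq) (decode-encode y i))

  surjective⇒injectiveᵛ : ∀ {n} {Φ : (Fin n → Carrier) → (Fin n → Carrier)} →
    Congruent _≗_ _≗_ Φ → (∀ y → ∃ λ x → Φ x ≗ y) → Injective _≗_ _≗_ Φ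
  surjective⇒injectiveᵛ {n} {Φ} Φ-cong Φ-surj {x} {y} Φx≗Φy =
    encode-injective (trans (sym (encode-decode n (encode x)))
      (trans (cong (encode ∘ decode n) (onCodes-surjective-injective (encode-cong Φ′x≗Φ′y)))
             (encode-decode n (encode y))))
    where
    onCodes-surjective-injective : Injective _≡_ _≡_ (onCodes Φ)
    onCodes-surjective-injective = surjective⇒injective λ k →
      let (x , Φx≗y) = Φ-surj (decode n k) in
      encode x , trans (encode-cong (Φ-cong (decode-encode x))) (trans (encode-cong Φx≗y) (encode-decode n k))
    Φ′x≗Φ′y : Φ (decode n (encode x)) ≗ Φ (decode n (encode y))
    Φ′x≗Φ′y i = trans (Φ-cong (decode-encode x) i) (trans (Φx≗Φy i) (sym (Φ-cong (decode-encode y) i)))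

  pigeonholeᵛ : ∀ {m n} → m < n → (Ψ : (Fin n → Carrier) → (Fin m → Carrier)) →
    ∃₂ λ x y → ¬ (x ≗ y) × Ψ x ≗ Ψ y
  pigeonholeᵛ {n = n} m<n Ψ
    with i , j , i<j , eq ← FinP.pigeonhole (ℕP.^-monoʳ-< Q (ℕ.s≤s 1≤q′) m<n) (onCodes Ψ) =
    decode n i , decode n j ,
    (λ x≗y → ℕP.<-irrefl (cong toℕ (trans (sym (encode-decode n i)) (trans (encode-cong x≗y) (encode-decode n j)))) i<j) ,
    encode-injective eq

  count-isZero : count (isZero ∘ toF) ≡ 1
  count-isZero = count-injection (isZero ∘ toF) (λ (_ : Fin 1) → fromF 0#) (λ { {zero} {zero} _ → refl })
    (λ _ → ≡0⇒isZero (toF-fromF 0#))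
    (λ c c≡0 → zero , trans (cong fromF (sym (isZero-≡0 c≡0))) (fromF-toF c))

  countV-∷ : ∀ n (R : (Fin (suc n) → Carrier) → Bool) → Congruent _≗_ _≡_ R →
    countV (suc n) R ≡ sum {Q} (λ c → countV n (λ y → R (toF c Vector.∷ y)))
  countV-∷ n R R-cong = trans (sum-combine Q (Q ^ n) _) (sum-cong-≗ λ c → sum-cong-≗ λ r →
    cong 𝟙 (R-cong (decode-combine c r)))
    where
    decode-combine : ∀ c r → decode (suc n) (combine c r) ≗ toF c Vector.∷ decode n r
    decode-combine c r zero    = cong (toF ∘ proj₁) (FinP.remQuot-combine c r)
    decode-combine c r (suc i) = cong (λ p → toF (Fin.finToFun (proj₂ p) i)) (FinP.remQuot-combine c r)

  zerosBelow : ℕ → ∀ {n} → (Fin n → Carrier) → Bool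
  zerosBelow zero    y = true
  zerosBelow (suc j) {zero}  y = true
  zerosBelow (suc j) {suc n} y = isZero (y zero) ∧ zerosBelow j (y ∘ suc)

  zerosBelow-cong : ∀ j {n} → Congruent _≗_ _≡_ (zerosBelow j {n})
  zerosBelow-cong zero    x≗y = refl
  zerosBelow-cong (suc j) {zero}  x≗y = refl
  zerosBelow-cong (suc j) {suc n} x≗y = cong₂ _∧_ (cong isZero (x≗y zero)) (zerosBelow-cong j (x≗y ∘ suc))

  zerosBelow⇒ : ∀ j {n} (y : Fin n → Carrier) → zerosBelow j y ≡ true → ∀ i → toℕ i < j → y i ≡ 0#
  zerosBelow⇒ (suc j) {suc n} y h i i<j with isZero (y zero) in y₀
  zerosBelow⇒ (suc j) {suc n} y h zero    i<j | true = isZero-≡0 y₀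
  zerosBelow⇒ (suc j) {suc n} y h (suc i) i<j | true = zerosBelow⇒ j (y ∘ suc) h i (ℕP.≤-pred i<j)

  ⇒zerosBelow : ∀ j {n} (y : Fin n → Carrier) → (∀ i → toℕ i < j → y i ≡ 0#) → zerosBelow j y ≡ true
  ⇒zerosBelow zero    y y≡0 = refl
  ⇒zerosBelow (suc j) {zero}  y y≡0 = refl
  ⇒zerosBelow (suc j) {suc n} y y≡0
    rewrite ≡0⇒isZero (y≡0 zero (ℕ.s≤s ℕ.z≤n)) = ⇒zerosBelow j (y ∘ suc) (λ i i<j → y≡0 (suc i) (ℕ.s≤s i<j))

  countV-zerosBelow : ∀ n j → countV n (zerosBelow j) ≡ Q ^ (n ∸ j)
  countV-zerosBelow n       zero    = count-const-true (Q ^ n)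
  countV-zerosBelow zero    (suc j) = refl
  countV-zerosBelow (suc n) (suc j) = begin
    countV (suc n) (zerosBelow (suc j))                           ≡⟨ countV-∷ n _ (zerosBelow-cong (suc j)) ⟩
    sum (λ c → countV n (λ y → isZero (toF c) ∧ zerosBelow j y))
      ≡⟨ sum-cong-≗ (λ c → count-∧ (isZero (toF c)) (zerosBelow j ∘ decode n)) ⟩
    sum (λ c → 𝟙 (isZero (toF c)) ℕ.* countV n (zerosBelow j))    ≡⟨ sym (*-distribʳ-sum _ (𝟙 ∘ isZero ∘ toF)) ⟩
    count (isZero ∘ toF) ℕ.* countV n (zerosBelow j)              ≡⟨ cong₂ ℕ._*_ count-isZero (countV-zerosBelow n j) ⟩
    1 ℕ.* Q ^ (n ∸ j)                                             ≡⟨ ℕP.*-identityˡ _ ⟩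
    Q ^ (suc n ∸ suc j)                                           ∎
    where open ≡-Reasoning

  ∑-neg : ∀ {n} (f : Fin n → Carrier) → ∑ (λ i → - f i) ≡ - ∑ f
  ∑-neg {zero}  f = sym -0#≈0#
  ∑-neg {suc n} f = trans (cong (- f zero +_) (∑-neg (f ∘ suc))) (-‿+-comm (f zero) _)

  ∑-− : ∀ {n} (f g : Fin n → Carrier) → ∑ (λ i → f i - g i) ≡ ∑ f - ∑ g
  ∑-− f g = trans (∑-distrib-+ᶠ f (λ i → - g i)) (cong (∑ f +_) (∑-neg g))

  kronecker : ∀ {n} → Fin n → Fin n → Carrier
  kronecker i j = if does (i Fin.≟ j) then 1# else 0#

  ∑-kronecker : ∀ {n} (f : Fin n → Carrier) i → ∑ (λ j → f j * kronecker i j) ≡ f i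
  ∑-kronecker {suc n} f zero =
    trans (cong₂ _+_ (*-identityʳ (f zero)) (trans (∑-cong (λ j → zeroʳ (f (suc j)))) (∑-zero n))) (+-identityʳ _)
  ∑-kronecker {suc n} f (suc i) = trans (cong (_+ ∑ (λ j → f (suc j) * kronecker i j)) (zeroʳ (f zero)))
    (trans (+-identityˡ _) (∑-kronecker (f ∘ suc) i))

  kronecker-comm : ∀ {n} (i j : Fin n) → kronecker i j ≡ kronecker j i
  kronecker-comm zero    zero    = refl
  kronecker-comm zero    (suc j) = refl
  kronecker-comm (suc i) zero    = refl
  kronecker-comm (suc i) (suc j) = kronecker-comm i j

  kronecker-≢ : ∀ {n} {i j : Fin n} → i ≢ j → kronecker i j ≡ 0#
  kronecker-≢ {i = i} {j} i≢j = cong (if_then 1# else 0#) (dec-false (i Fin.≟ j) i≢j)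

  kronecker-refl : ∀ {n} (i : Fin n) → kronecker i i ≡ 1#
  kronecker-refl i = cong (if_then 1# else 0#) (dec-true (i Fin.≟ i) refl)

  Nonzero : ∀ {n} → (Fin n → Carrier) → Set
  Nonzero a = ∃ λ k → a k ≢ 0#

  nonzero-coordinate : ∀ {n} (a : Fin n → Carrier) → ¬ (∀ k → a k ≡ 0#) → Nonzero a
  nonzero-coordinate a a≢0 with FinP.any? (λ k → ¬? (a k ≟ 0#))
  ... | yes hit  = hit
  ... | no  none = contradiction (λ k → decidable-stable (a k ≟ 0#) (λ aₖ≢0 → none (k , aₖ≢0))) a≢0

  module Linear (N : ℕ) where
    open Space F N

    dot : X → X → Carrier
    dot a x = ∑ (λ i → a i * x i)

    dot-congˡ : ∀ {a a′ : X} → a ≗ a′ → ∀ x → dot a x ≡ dot a′ x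
    dot-congˡ a≗a′ x = ∑-cong (λ i → cong (_* x i) (a≗a′ i))

    dot-congʳ : ∀ a {x x′ : X} → x ≗ x′ → dot a x ≡ dot a x′
    dot-congʳ a x≗x′ = ∑-cong (λ i → cong (a i *_) (x≗x′ i))

    dot-⊕ʳ : ∀ a u v → dot a (u ⊕ v) ≡ dot a u + dot a v
    dot-⊕ʳ a u v = trans (∑-cong (λ i → distribˡ (a i) (u i) (v i))) (∑-distrib-+ᶠ (λ i → a i * u i) (λ i → a i * v i))

    dot-⊙ʳ : ∀ a c v → dot a (c ⊙ v) ≡ c * dot a v
    dot-⊙ʳ a c v = trans (∑-cong (λ i → x[cy]≡c[xy] (a i) (v i))) (sym (*-distribˡ-∑ c (λ i → a i * v i)))
      where
      x[cy]≡c[xy] : ∀ x y → x * (c * y) ≡ c * (x * y)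
      x[cy]≡c[xy] x y = trans (sym (*-assoc x c y)) (trans (cong (_* y) (*-comm x c)) (*-assoc c x y))

    dot-⊙ˡ : ∀ c a x → dot (c ⊙ a) x ≡ c * dot a x
    dot-⊙ˡ c a x = trans (∑-cong (λ i → *-assoc c (a i) (x i))) (sym (*-distribˡ-∑ c (λ i → a i * x i)))

    dot-−ˡ : ∀ a a′ x → dot (λ i → a i - a′ i) x ≡ dot a x - dot a′ x
    dot-−ˡ a a′ x = trans (∑-cong (λ i → [y-z]x≈yx-zx (x i) (a i) (a′ i))) (∑-− (λ i → a i * x i) (λ i → a′ i * x i))

    dot-zeroʳ : ∀ a → dot a zeroV ≡ 0#
    dot-zeroʳ a = trans (∑-cong (λ i → zeroʳ (a i))) (∑-zero N)

    dot-zeroˡ : ∀ x → dot zeroV x ≡ 0#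
    dot-zeroˡ x = trans (∑-cong (λ i → zeroˡ (x i))) (∑-zero N)

    lincomb-apply : ∀ k c v (j : Fin N) → lincomb k c v j ≡ ∑ (λ i → c i * v i j)
    lincomb-apply zero    c v j = refl
    lincomb-apply (suc k) c v j = cong (c zero * v zero j +_) (lincomb-apply k (c ∘ suc) (v ∘ suc) j)

    lincomb-cong : ∀ k {c c′} v → c ≗ c′ → lincomb k c v ≡ lincomb k c′ v
    lincomb-cong zero    v c≗c′ = refl
    lincomb-cong (suc k) v c≗c′ = cong₂ (λ c₀ rest → (c₀ ⊙ v zero) ⊕ rest) (c≗c′ zero) (lincomb-cong k (v ∘ suc) (c≗c′ ∘ suc))

    lincomb-∈ : ∀ {V} → IsSubspace V → ∀ k c v → (∀ i → v i ∈ V) → lincomb k c v ∈ V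
    lincomb-∈ V-sub zero    c v v∈V = IsSubspace.zero∈ V-sub
    lincomb-∈ V-sub (suc k) c v v∈V =
      IsSubspace.+∈ V-sub _ _ (IsSubspace.·∈ V-sub _ _ (v∈V zero)) (lincomb-∈ V-sub k (c ∘ suc) (v ∘ suc) (v∈V ∘ suc))

    dot-lincomb : ∀ a k c v → dot a (lincomb k c v) ≡ ∑ (λ i → c i * dot a (v i))
    dot-lincomb a zero    c v = dot-zeroʳ a
    dot-lincomb a (suc k) c v =
      trans (dot-⊕ʳ a _ _) (cong₂ _+_ (dot-⊙ʳ a (c zero) (v zero)) (dot-lincomb a k (c ∘ suc) (v ∘ suc)))

    dot-sumV : ∀ a k y → dot a (sumV k y) ≡ ∑ (λ i → dot a (y i))
    dot-sumV a zero    y = dot-zeroʳ a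
    dot-sumV a (suc k) y = trans (dot-⊕ʳ a _ _) (cong (dot a (y zero) +_) (dot-sumV a k (y ∘ suc)))

    sumV-cong : ∀ m {y y′ : Fin m → X} → (∀ i → y i ≡ y′ i) → sumV m y ≡ sumV m y′
    sumV-cong zero    y≡y′ = refl
    sumV-cong (suc m) y≡y′ = cong₂ _⊕_ (y≡y′ zero) (sumV-cong m (y≡y′ ∘ suc))

    basis : Fin N → X
    basis = kronecker

    dot-basis : ∀ a k → dot a (basis k) ≡ a k
    dot-basis a k = ∑-kronecker a k

    dot-injectiveˡ : ∀ {a a′} → (∀ x → dot a x ≡ dot a′ x) → a ≗ a′
    dot-injectiveˡ {a} {a′} same j = trans (sym (dot-basis a j)) (trans (same (basis j)) (dot-basis a′ j))

    ker : X → SubsetX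
    ker a x = isZero (dot a x)

    ker-isSubspace : ∀ a → IsSubspace (ker a)
    ker-isSubspace a = record
      { zero∈ = ≡0⇒isZero (dot-zeroʳ a)
      ; +∈    = λ x y x∈ y∈ → ≡0⇒isZero (trans (dot-⊕ʳ a x y)
                  (trans (cong₂ _+_ (isZero-≡0 x∈) (isZero-≡0 y∈)) (+-identityʳ 0#)))
      ; ·∈    = λ c x x∈ → ≡0⇒isZero (trans (dot-⊙ʳ a c x) (trans (cong (c *_) (isZero-≡0 x∈)) (zeroʳ c)))
      }

    ker-⊙ : ∀ {c} a → c ≢ 0# → ker (c ⊙ a) ≐ ker a
    ker-⊙ {c} a c≢0 x with dot a x ≟ 0#
    ... | yes ax≡0 = trans (≡0⇒isZero (trans (dot-⊙ˡ c a x) (trans (cong (c *_) ax≡0) (zeroʳ c)))) (sym (≡0⇒isZero ax≡0))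
    ... | no  ax≢0 = trans (≢0⇒isZero (λ eq → *-≢0 c≢0 ax≢0 (trans (sym (dot-⊙ˡ c a x)) eq))) (sym (≢0⇒isZero ax≢0))

    lincomb-− : ∀ k c c′ v (j : Fin N) → lincomb k (λ i → c i - c′ i) v j ≡ lincomb k c v j - lincomb k c′ v j
    lincomb-− k c c′ v j = begin
      lincomb k (λ i → c i - c′ i) v j          ≡⟨ lincomb-apply k _ v j ⟩
      ∑ (λ i → (c i - c′ i) * v i j)            ≡⟨ ∑-cong (λ i → [y-z]x≈yx-zx (v i j) (c i) (c′ i)) ⟩
      ∑ (λ i → c i * v i j - c′ i * v i j)      ≡⟨ ∑-− (λ i → c i * v i j) (λ i → c′ i * v i j) ⟩
      ∑ (λ i → c i * v i j) - ∑ (λ i → c′ i * v i j) ≡⟨ sym (cong₂ _-_ (lincomb-apply k c v j) (lincomb-apply k c′ v j)) ⟩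
      lincomb k c v j - lincomb k c′ v j        ∎
      where open ≡-Reasoning

    independent⇒spanning : (w : Fin N → X) → (∀ d → lincomb N d w ≗ zeroV → ∀ i → d i ≡ 0#) →
      ∀ y → ∃ λ d → lincomb N d w ≗ y
    independent⇒spanning w indep = injective⇒surjectiveᵛ
      (λ d≗d′ j → cong (λ v → v j) (lincomb-cong N w d≗d′))
      (λ {d} {d′} Λd≗Λd′ i → x∙y⁻¹≈ε⇒x≈y _ _ (indep (λ i → d i - d′ i)
        (λ j → trans (lincomb-− N d d′ w j) (trans (cong (_- _) (Λd≗Λd′ j)) (-‿inverseʳ _))) i))

  -- ext is obtained from the arc, see Arc.ext.
  module Hyperplanes (K : ℕ) (ext : ∀ {x y : Space.X F (suc K)} → x ≗ y → x ≡ y) where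
    open Space F (suc K)
    open Linear (suc K)

    module Kernel (a : X) (k : Fin (suc K)) (aₖ≢0 : a k ≢ 0#) where
      aₖ⁻¹ : Carrier
      aₖ⁻¹ = inv (a k) aₖ≢0

      slope : Fin K → Carrier
      slope i = - (a (punchIn k i) * aₖ⁻¹)

      b : Fin K → X
      b i = basis (punchIn k i) ⊕ (slope i ⊙ basis k)

      dot-b : ∀ a′ i → dot a′ (b i) ≡ a′ (punchIn k i) + slope i * a′ k
      dot-b a′ i = trans (dot-⊕ʳ a′ (basis (punchIn k i)) (slope i ⊙ basis k))
        (cong₂ _+_ (dot-basis a′ _) (trans (dot-⊙ʳ a′ (slope i) (basis k)) (cong (slope i *_) (dot-basis a′ k))))

      slope-*-aₖ : ∀ i → slope i * a k ≡ - a (punchIn k i)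
      slope-*-aₖ i = begin
        - (A * aₖ⁻¹) * a k    ≡⟨ sym (-‿distribˡ-* _ _) ⟩
        - (A * aₖ⁻¹ * a k)    ≡⟨ cong -_ (*-assoc A _ _) ⟩
        - (A * (aₖ⁻¹ * a k))  ≡⟨ cong (λ t → - (A * t)) (*-inverseˡ (a k) aₖ≢0) ⟩
        - (A * 1#)            ≡⟨ cong -_ (*-identityʳ A) ⟩
        - A                   ∎
        where
        open ≡-Reasoning
        A = a (punchIn k i)

      b-∈ker : ∀ i → dot a (b i) ≡ 0#
      b-∈ker i = trans (dot-b a i) (trans (cong (_ +_) (slope-*-aₖ i)) (-‿inverseʳ _))

      b-punchIn : ∀ i i′ → b i (punchIn k i′) ≡ kronecker i i′
      b-punchIn i i′ = trans (cong₂ _+_ kronecker-punchIn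
        (trans (cong (slope i *_) (kronecker-≢ (FinP.punchInᵢ≢i k i′ ∘ sym))) (zeroʳ _))) (+-identityʳ _)
        where
        kronecker-punchIn : kronecker (punchIn k i) (punchIn k i′) ≡ kronecker i i′
        kronecker-punchIn with i Fin.≟ i′
        ... | yes refl = kronecker-refl (punchIn k i)
        ... | no i≢i′  = kronecker-≢ (i≢i′ ∘ FinP.punchIn-injective k i i′)

      b-at-k : ∀ i → b i k ≡ slope i
      b-at-k i = trans (cong₂ _+_ (kronecker-≢ (FinP.punchInᵢ≢i k i))
        (trans (cong (slope i *_) (kronecker-refl k)) (*-identityʳ _))) (+-identityˡ _)

      lincomb-b-punchIn : ∀ c i′ → lincomb K c b (punchIn k i′) ≡ c i′
      lincomb-b-punchIn c i′ = trans (lincomb-apply K c b _) (trans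
        (∑-cong (λ m → cong (c m *_) (trans (b-punchIn m i′) (kronecker-comm m i′)))) (∑-kronecker c i′))

      b-independent : ∀ c → lincomb K c b ≡ zeroV → ∀ i → c i ≡ 0#
      b-independent c eq i = trans (sym (lincomb-b-punchIn c i)) (cong (λ v → v (punchIn k i)) eq)

      lincomb-b-at-k : ∀ x → dot a x ≡ 0# → lincomb K (x ∘ punchIn k) b k ≡ x k
      lincomb-b-at-k x ax≡0 = begin
        lincomb K (x ∘ punchIn k) b k                    ≡⟨ lincomb-apply K _ b k ⟩
        ∑ (λ m → x (punchIn k m) * b m k)                ≡⟨ ∑-cong (λ m → trans (cong (_ *_) (b-at-k m)) (y*slope m)) ⟩
        ∑ (λ m → - (a (punchIn k m) * x (punchIn k m)) * aₖ⁻¹) ≡⟨ sym (*-distribʳ-∑ aₖ⁻¹ (λ m → - axₘ m)) ⟩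
        ∑ (λ m → - (a (punchIn k m) * x (punchIn k m))) * aₖ⁻¹ ≡⟨ cong (_* aₖ⁻¹) (trans (∑-neg axₘ) (cong -_ rest≡)) ⟩
        - - (a k * x k) * aₖ⁻¹                           ≡⟨ cong (_* aₖ⁻¹) (-‿involutive _) ⟩
        a k * x k * aₖ⁻¹                                 ≡⟨ cong (_* aₖ⁻¹) (*-comm (a k) (x k)) ⟩
        x k * a k * aₖ⁻¹                                 ≡⟨ *-assoc (x k) _ _ ⟩
        x k * (a k * aₖ⁻¹)                               ≡⟨ cong (x k *_) (*-inverseʳ (a k) aₖ≢0) ⟩
        x k * 1#                                         ≡⟨ *-identityʳ (x k) ⟩
        x k                                              ∎
        where
        open ≡-Reasoning
        y*slope : ∀ m → x (punchIn k m) * slope m ≡ - (a (punchIn k m) * x (punchIn k m)) * aₖ⁻¹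
        y*slope m = begin
          y * - (A * aₖ⁻¹)   ≡⟨ sym (-‿distribʳ-* y _) ⟩
          - (y * (A * aₖ⁻¹)) ≡⟨ cong -_ (sym (*-assoc y A _)) ⟩
          - (y * A * aₖ⁻¹)   ≡⟨ cong (λ t → - (t * aₖ⁻¹)) (*-comm y A) ⟩
          - (A * y * aₖ⁻¹)   ≡⟨ -‿distribˡ-* _ _ ⟩
          - (A * y) * aₖ⁻¹   ∎
          where
          y = x (punchIn k m)
          A = a (punchIn k m)
        axₘ : Fin K → Carrier
        axₘ m = a (punchIn k m) * x (punchIn k m)
        rest≡ : ∑ axₘ ≡ - (a k * x k)
        rest≡ = +-inverseʳ-unique _ _ (trans (sym (∑-remove {i = k} (λ j → a j * x j))) ax≡0)

      b-spans : ∀ x → x ∈ ker a → ∃ λ c → lincomb K c b ≡ x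
      b-spans x x∈ker = x ∘ punchIn k , ext coordinate
        where
        coordinate : ∀ j → lincomb K (x ∘ punchIn k) b j ≡ x j
        coordinate j with k Fin.≟ j
        ... | yes refl = lincomb-b-at-k x (isZero-≡0 x∈ker)
        ... | no k≢j   = subst (λ j → lincomb K (x ∘ punchIn k) b j ≡ x j) (FinP.punchIn-punchOut k≢j)
                           (lincomb-b-punchIn (x ∘ punchIn k) (punchOut k≢j))

      ker-isHyperplane : IsSubspaceOfDim K (ker a)
      ker-isHyperplane = ker-isSubspace a , b , record
        { inV = ≡0⇒isZero ∘ b-∈ker ; indep = b-independent ; spans = b-spans }

      ker-≐⇒distinguishing-fractional : ∀ a′ → ker a ≐ ker a′ → a′ ≗ (a′ k * aₖ⁻¹) ⊙ a
      ker-≐⇒distinguishing-fractional a′ same j with k Fin.≟ j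
      ... | yes refl = sym (trans (*-assoc (a′ k) _ _) (trans (cong (a′ k *_) (*-inverseˡ (a k) aₖ≢0)) (*-identityʳ _)))
      ... | no k≢j   = subst (λ j → a′ j ≡ (a′ k * aₖ⁻¹) * a j) (FinP.punchIn-punchOut k≢j) (off-k (punchOut k≢j))
        where
        off-k : ∀ i → a′ (punchIn k i) ≡ (a′ k * aₖ⁻¹) * a (punchIn k i)
        off-k i = begin
          a′ (punchIn k i)               ≡⟨ +-inverseˡ-unique _ _ a′bᵢ≡0 ⟩
          - (slope i * a′ k)             ≡⟨ cong -_ (sym (-‿distribˡ-* _ _)) ⟩
          - - (A * aₖ⁻¹ * a′ k)          ≡⟨ -‿involutive _ ⟩
          A * aₖ⁻¹ * a′ k                ≡⟨ *-comm _ (a′ k) ⟩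
          a′ k * (A * aₖ⁻¹)              ≡⟨ cong (a′ k *_) (*-comm A _) ⟩
          a′ k * (aₖ⁻¹ * A)              ≡⟨ sym (*-assoc (a′ k) _ A) ⟩
          a′ k * aₖ⁻¹ * A                ∎
          where
          open ≡-Reasoning
          A = a (punchIn k i)
          a′bᵢ≡0 : a′ (punchIn k i) + slope i * a′ k ≡ 0#
          a′bᵢ≡0 = trans (sym (dot-b a′ i)) (isZero-≡0 (trans (sym (same (b i))) (≡0⇒isZero (b-∈ker i))))

    orthogonal-functional : (b : Fin K → X) → ∃ λ a → Nonzero a × (∀ m → dot a (b m) ≡ 0#)
    orthogonal-functional b with a₁ , a₂ , a₁≉a₂ , same ← pigeonholeᵛ (ℕP.n<1+n K) (λ a m → dot a (b m)) =
      let a = λ i → a₁ i - a₂ i in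
      a , nonzero-coordinate a (λ a≗0 → a₁≉a₂ (λ i → x∙y⁻¹≈ε⇒x≈y _ _ (a≗0 i))) ,
      λ m → trans (dot-−ˡ a₁ a₂ (b m)) (trans (cong (_- dot a₂ (b m)) (same m)) (-‿inverseʳ _))

    module _ {V : SubsetX} (V-sub : IsSubspace V) {b : Fin K → X} (b-basis : IsBasis V K b) where

      ∉⇒independent : ∀ x → V x ≡ false → ∀ d → lincomb (suc K) d (x Vector.∷ b) ≗ zeroV → ∀ i → d i ≡ 0#
      ∉⇒independent x x∉V d Λd≗0 with d zero ≟ 0#
      ... | no d₀≢0 = contradiction (trans (sym x∉V) (subst (_∈ V) (sym x≡) (IsSubspace.·∈ V-sub _ B B∈V))) λ ()
        where
        B = lincomb K (d ∘ suc) b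
        B∈V : B ∈ V
        B∈V = lincomb-∈ V-sub K (d ∘ suc) b (IsBasis.inV b-basis)
        x≡ : x ≡ (- inv (d zero) d₀≢0) ⊙ B
        x≡ = ext λ j → trans (*-solveˡ (d zero) d₀≢0 (+-inverseˡ-unique _ _ (Λd≗0 j)))
                              (trans (sym (-‿distribʳ-* _ _)) (-‿distribˡ-* _ _))
      ... | yes d₀≡0 = λ { zero → d₀≡0 ; (suc m) → IsBasis.indep b-basis (d ∘ suc) (ext B≗0) m }
        where
        B = lincomb K (d ∘ suc) b
        B≗0 : B ≗ zeroV
        B≗0 j = begin
          B j                   ≡⟨ sym (+-identityˡ (B j)) ⟩
          0# + B j              ≡⟨ cong (_+ B j) (sym (zeroˡ (x j))) ⟩
          0# * x j + B j        ≡⟨ cong (λ c → c * x j + B j) (sym d₀≡0) ⟩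
          d zero * x j + B j    ≡⟨ Λd≗0 j ⟩
          0#                    ∎
          where open ≡-Reasoning

      ∉⇒spanning : ∀ x → V x ≡ false → ∀ y → ∃ λ d → lincomb (suc K) d (x Vector.∷ b) ≗ y
      ∉⇒spanning x x∉V = independent⇒spanning (x Vector.∷ b) (∉⇒independent x x∉V)

      annihilates-outside⇒zero : ∀ a → (∀ m → dot a (b m) ≡ 0#) → ∀ x → V x ≡ false → dot a x ≡ 0# → ∀ k → a k ≡ 0#
      annihilates-outside⇒zero a a⊥b x x∉V a⊥x k = begin
        a k                                             ≡⟨ sym (dot-basis a k) ⟩
        dot a (basis k)                                 ≡⟨ dot-congʳ a (sym ∘ Λd≗eₖ) ⟩
        dot a (lincomb (suc K) d (x Vector.∷ b))        ≡⟨ dot-lincomb a (suc K) d (x Vector.∷ b) ⟩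
        ∑ (λ i → d i * dot a ((x Vector.∷ b) i))        ≡⟨ ∑-cong (λ i → trans (cong (d i *_) (a⊥x∷b i)) (zeroʳ _)) ⟩
        ∑ {suc K} (λ _ → 0#)                            ≡⟨ ∑-zero (suc K) ⟩
        0#                                              ∎
        where
        open ≡-Reasoning
        d : Fin (suc K) → Carrier
        d = proj₁ (∉⇒spanning x x∉V (basis k))
        Λd≗eₖ : lincomb (suc K) d (x Vector.∷ b) ≗ basis k
        Λd≗eₖ = proj₂ (∉⇒spanning x x∉V (basis k))
        a⊥x∷b : ∀ i → dot a ((x Vector.∷ b) i) ≡ 0#
        a⊥x∷b zero    = a⊥x
        a⊥x∷b (suc m) = a⊥b m

      annihilator-ker : ∀ a k → a k ≢ 0# → (∀ m → dot a (b m) ≡ 0#) → V ≐ ker a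
      annihilator-ker a k aₖ≢0 a⊥b x = ≡true-⇔⇒≡ V⊆ker ker⊆V
        where
        V⊆ker : x ∈ V → x ∈ ker a
        V⊆ker x∈V with c , refl ← IsBasis.spans b-basis x x∈V =
          ≡0⇒isZero (trans (dot-lincomb a K c b) (trans (∑-cong (λ m → trans (cong (c m *_) (a⊥b m)) (zeroʳ _))) (∑-zero K)))
        ker⊆V : x ∈ ker a → x ∈ V
        ker⊆V x∈ker with V x in Vx
        ... | true  = refl
        ... | false = contradiction (annihilates-outside⇒zero a a⊥b x Vx (isZero-≡0 x∈ker) k) aₖ≢0

    hyperplane⇒ker : ∀ V → IsSubspaceOfDim K V → ∃ λ a → Nonzero a × V ≐ ker a
    hyperplane⇒ker V (V-sub , b , b-basis) with a , (k , aₖ≢0) , a⊥b ← orthogonal-functional b =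
      a , (k , aₖ≢0) , annihilator-ker V-sub b-basis a k aₖ≢0 a⊥b

  module Arc (K : ℕ) {ℓ} (P : Space.PointSet F (suc K) ℓ) (arc : Space.IsArc F (suc K) P) (N≤ℓ : suc K ≤ ℓ) where
    N : ℕ
    N = suc K
    open Space F N
    open Linear N
    open PointSet P
    open import Data.List.Membership.DecPropositional (FinP._≟_ {ℓ}) using (_∈?_; _∉?_)

    point : Fin ℓ → X
    point k = proj₁ (proj₂ (isPoint k)) zero

    point-∈ : ∀ k → point k ∈ pt k
    point-∈ k = IsBasis.inV (proj₂ (proj₂ (isPoint k))) zero

    ∈pt⇒multiple : ∀ k x → x ∈ pt k → ∃ λ c → (c ⊙ point k) ⊕ zeroV ≡ x
    ∈pt⇒multiple k x x∈ with c , eq ← IsBasis.spans (proj₂ (proj₂ (isPoint k))) x x∈ = c zero , eq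

    point-∈⇒pt-⊆ : ∀ {V} → IsSubspace V → ∀ k → point k ∈ V → pt k ⊆ V
    point-∈⇒pt-⊆ V-sub k pₖ∈V x x∈ with c , refl ← ∈pt⇒multiple k x x∈ =
      IsSubspace.+∈ V-sub _ _ (IsSubspace.·∈ V-sub c (point k) pₖ∈V) (IsSubspace.zero∈ V-sub)

    combination : (Fin N → Fin ℓ) → (Fin N → Carrier) → X
    combination σ c = sumV N (λ i → (c i ⊙ point (σ i)) ⊕ zeroV)

    combination-cong : ∀ σ {c c′} → c ≗ c′ → combination σ c ≡ combination σ c′
    combination-cong σ c≗c′ = sumV-cong N (λ i → cong (λ t → (t ⊙ point (σ i)) ⊕ zeroV) (c≗c′ i))

    arc-spans : ∀ σ → (∀ i j → σ i ≡ σ j → i ≡ j) → ∀ x → ∃ λ c → combination σ c ≡ x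
    arc-spans σ σ-inj x with y , y∈ , sum≡x ← arc σ σ-inj x =
      (λ i → proj₁ (∈pt⇒multiple (σ i) (y i) (y∈ i))) ,
      trans (sumV-cong N (λ i → proj₂ (∈pt⇒multiple (σ i) (y i) (y∈ i)))) sum≡x

    dot-combination : ∀ a σ c → dot a (combination σ c) ≡ ∑ (λ i → c i * dot a (point (σ i)))
    dot-combination a σ c = trans (dot-sumV a N (λ i → (c i ⊙ point (σ i)) ⊕ zeroV)) (∑-cong λ i →
      trans (dot-⊕ʳ a (c i ⊙ point (σ i)) zeroV)
        (trans (cong₂ _+_ (dot-⊙ʳ a (c i) (point (σ i))) (dot-zeroʳ a)) (+-identityʳ _)))

    σ₀ : Fin N → Fin ℓ
    σ₀ i = Fin.inject≤ i N≤ℓ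

    σ₀-injective : ∀ i j → σ₀ i ≡ σ₀ j → i ≡ j
    σ₀-injective i j = FinP.inject≤-injective N≤ℓ N≤ℓ i j

    -- Both vectors are combinations of the first N arc points, and the coefficients
    -- are unique because the combination map is onto a finite set of the same size.
    ext : ∀ {x y : X} → x ≗ y → x ≡ y
    ext {x} {y} x≗y
      with cx , refl ← arc-spans σ₀ σ₀-injective x | cy , refl ← arc-spans σ₀ σ₀-injective y =
      combination-cong σ₀ {cx} {cy} (coefficients-unique {cx} {cy} x≗y)
      where
      coefficients-unique : Injective _≗_ _≗_ (combination σ₀)
      coefficients-unique = surjective⇒injectiveᵛ
        (λ c≗c′ j → cong (λ v → v j) (combination-cong σ₀ c≗c′))
        (λ y → let (c , eq) = arc-spans σ₀ σ₀-injective y in c , λ j → cong (λ v → v j) eq)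

    evaluate : (Fin N → Fin ℓ) → X → X
    evaluate σ a i = dot a (point (σ i))

    evaluate-cong : ∀ σ → Congruent _≗_ _≗_ (evaluate σ)
    evaluate-cong σ a≗a′ i = dot-congˡ a≗a′ (point (σ i))

    evaluate-injective : ∀ σ → (∀ i j → σ i ≡ σ j → i ≡ j) → Injective _≗_ _≗_ (evaluate σ)
    evaluate-injective σ σ-inj {a} {a′} same = dot-injectiveˡ λ x →
      let (c , eq) = arc-spans σ σ-inj x in begin
        dot a x                                    ≡⟨ cong (dot a) (sym eq) ⟩
        dot a (combination σ c)                    ≡⟨ dot-combination a σ c ⟩
        ∑ (λ i → c i * evaluate σ a i)             ≡⟨ ∑-cong (λ i → cong (c i *_) (same i)) ⟩
        ∑ (λ i → c i * evaluate σ a′ i)            ≡⟨ sym (dot-combination a′ σ c) ⟩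
        dot a′ (combination σ c)                   ≡⟨ cong (dot a′) eq ⟩
        dot a′ x                                   ∎
      where open ≡-Reasoning

    open Hyperplanes K ext

    -- The functionals with kernel in the family are unit c ⊙ functional i, each exactly once.
    module CountKernels {S : SubsetX → Set} {n} (card : HasCard S n) (S⇒hyperplane : ∀ V → S V → IsSubspaceOfDim K V) where
      open HasCard card

      functional : Fin n → X
      functional i = proj₁ (hyperplane⇒ker (elems i) (S⇒hyperplane _ (members i)))

      functional-nonzero : ∀ i → Nonzero (functional i)
      functional-nonzero i = proj₁ (proj₂ (hyperplane⇒ker (elems i) (S⇒hyperplane _ (members i))))

      elems≐ker : ∀ i → elems i ≐ ker (functional i)
      elems≐ker i = proj₂ (proj₂ (hyperplane⇒ker (elems i) (S⇒hyperplane _ (members i))))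

      scale : Fin n → Fin q′ → X
      scale i c = unit c ⊙ functional i

      elems≐ker-scale : ∀ i c → elems i ≐ ker (scale i c)
      elems≐ker-scale i c x = trans (elems≐ker i x) (sym (ker-⊙ (functional i) (unit≢0 c) x))

      scale-nonzero : ∀ i c → Nonzero (scale i c)
      scale-nonzero i c = proj₁ (functional-nonzero i) , *-≢0 (unit≢0 c) (proj₂ (functional-nonzero i))

      scale-injectiveˡ : ∀ {i c i′ c′} → scale i c ≗ scale i′ c′ → i ≡ i′
      scale-injectiveˡ {i} {c} {i′} {c′} eq = HasCard.distinct card i i′ λ x →
        trans (elems≐ker-scale i c x) (trans (cong isZero (dot-congˡ eq x)) (sym (elems≐ker-scale i′ c′ x)))

      scale-injectiveʳ : ∀ {i c c′} → scale i c ≗ scale i c′ → c ≡ c′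
      scale-injectiveʳ {i} {c} {c′} eq = unit-injective (*-cancelˡ (functional i k) fₖ≢0
        (trans (*-comm (functional i k) (unit c)) (trans (eq k) (*-comm (unit c′) (functional i k)))))
        where
        k = proj₁ (functional-nonzero i)
        fₖ≢0 = proj₂ (functional-nonzero i)

      scale-injective : ∀ {i c i′ c′} → scale i c ≗ scale i′ c′ → i ≡ i′ × c ≡ c′
      scale-injective {i} {c} {i′} {c′} eq =
        i≡i′ , scale-injectiveʳ (subst (λ j → scale i c ≗ scale j c′) (sym i≡i′) eq)
        where
        i≡i′ = scale-injectiveˡ eq

      scale-onto : ∀ a → Nonzero a → S (ker a) → ∃₂ λ i c → scale i c ≗ a
      scale-onto a (j , aⱼ≢0) a∈S = i , c , λ x → trans (cong (_* functional i x) unit-c≡γ) (sym (a≗γf x))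
        where
        i = proj₁ (complete (ker a) a∈S)
        k = proj₁ (functional-nonzero i)
        fₖ≢0 = proj₂ (functional-nonzero i)
        γ = a k * inv (functional i k) fₖ≢0
        a≗γf : a ≗ γ ⊙ functional i
        a≗γf = Kernel.ker-≐⇒distinguishing-fractional (functional i) k fₖ≢0 a
          (λ x → sym (trans (proj₂ (complete (ker a) a∈S) x) (elems≐ker i x)))
        γ≢0 : γ ≢ 0#
        γ≢0 γ≡0 = aⱼ≢0 (trans (a≗γf j) (trans (cong (_* functional i j) γ≡0) (zeroˡ _)))
        c = proj₁ (unit-surjective γ γ≢0)
        unit-c≡γ : unit c ≡ γ
        unit-c≡γ = proj₂ (unit-surjective γ γ≢0)

      countV-kernels : (R : X → Bool) → (∀ a → R a ≡ true → Nonzero a × S (ker a)) →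
        (∀ V a → S V → V ≐ ker a → Nonzero a → R a ≡ true) → countV N R ≡ n ℕ.* q′
      countV-kernels R R⇒ ⇒R = countV-injection R (cong R ∘ ext) scaled scaled-injective
        (λ t → ⇒R _ (scaled t) (members _) (elems≐ker-scale _ _) (scale-nonzero _ _))
        onto
        where
        scaled : Fin (n ℕ.* q′) → X
        scaled t = uncurry scale (Fin.remQuot q′ t)
        scaled-injective : ∀ {t t′} → scaled t ≗ scaled t′ → t ≡ t′
        scaled-injective {t} {t′} eq = trans (sym (FinP.combine-remQuot {n} q′ t))
          (trans (cong₂ combine (proj₁ (scale-injective eq)) (proj₂ (scale-injective eq))) (FinP.combine-remQuot {n} q′ t′))
        onto : ∀ a → R a ≡ true → ∃ λ t → scaled t ≗ a
        onto a Ra = combine i c , subst (λ p → uncurry scale p ≗ a) (sym (FinP.remQuot-combine i c)) eq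
          where
          preimage = uncurry (scale-onto a) (R⇒ a Ra)
          i = proj₁ preimage
          c = proj₁ (proj₂ preimage)
          eq = proj₂ (proj₂ preimage)

    vanishesOn : List (Fin ℓ) → X → Bool
    vanishesOn Z a = all (λ k → isZero (dot a (point k))) Z

    avoids : List (Fin ℓ) → X → Bool
    avoids T a = all (λ k → not (isZero (dot a (point k)))) T

    countPattern : List (Fin ℓ) → List (Fin ℓ) → ℕ
    countPattern Z T = countV N (λ a → vanishesOn Z a ∧ avoids T a)

    -- One inclusion–exclusion step: a either vanishes at point k or it does not.
    countPattern-∷ : ∀ Z k T → countPattern Z T ≡ countPattern Z (k ∷ T) ℕ.+ countPattern (k ∷ Z) T
    countPattern-∷ Z k T = count-+ λ t → 𝟙-split (isZero (dot (decode N t) (point k))) _ _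
      where
      𝟙-split : ∀ z v r → 𝟙 (v ∧ r) ≡ 𝟙 (v ∧ (not z ∧ r)) ℕ.+ 𝟙 ((z ∧ v) ∧ r)
      𝟙-split false v     r = sym (ℕP.+-identityʳ _)
      𝟙-split true  false r = refl
      𝟙-split true  true  r = refl

    -- L lists every index with Z first, so σ picks N distinct arc points beginning with Z,
    -- and vanishing on Z becomes vanishing of the first |Z| coordinates of evaluate σ a.
    module Extension (Z : List (Fin ℓ)) (Z-unique : Unique Z) where
      rest : List (Fin ℓ)
      rest = filter (_∉? Z) (allFin ℓ)

      L : List (Fin ℓ)
      L = Z ++ rest

      L-covers : ∀ k → k ∈ₗ L
      L-covers k with k ∉? Z
      ... | yes k∉Z = ∈-++⁺ʳ Z (∈-filter⁺ (_∉? Z) (∈-allFin k) k∉Z)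
      ... | no ¬k∉Z = ∈-++⁺ˡ (decidable-stable (k ∈? Z) ¬k∉Z)

      L-unique : Unique L
      L-unique = Unique.++⁺ Z-unique (Unique.filter⁺ (_∉? Z) (Unique.allFin⁺ ℓ))
        λ (v∈Z , v∈rest) → proj₂ (∈-filter⁻ (_∉? Z) {xs = allFin ℓ} v∈rest) v∈Z

      N≤length : N ≤ length L
      N≤length = ℕP.≤-trans N≤ℓ (covering⇒≤length L L-covers)

      σ : Fin N → Fin ℓ
      σ i = lookup L (Fin.inject≤ i N≤length)

      σ-injective : ∀ i j → σ i ≡ σ j → i ≡ j
      σ-injective i j eq = FinP.inject≤-injective N≤length N≤length i j (lookup-injective L-unique eq)

      vanishesOn≡zerosBelow : ∀ a → vanishesOn Z a ≡ zerosBelow (length Z) (evaluate σ a)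
      vanishesOn≡zerosBelow a = ≡true-⇔⇒≡ ⇒ ⇐
        where
        ⇒ : vanishesOn Z a ≡ true → zerosBelow (length Z) (evaluate σ a) ≡ true
        ⇒ h = ⇒zerosBelow (length Z) (evaluate σ a) λ i i<|Z| → isZero-≡0 (all-∈ _ h
          (lookup-++-∈ Z (Fin.inject≤ i N≤length) (subst (ℕ._< length Z) (sym (FinP.toℕ-inject≤ i N≤length)) i<|Z|)))
        ⇐ : zerosBelow (length Z) (evaluate σ a) ≡ true → vanishesOn Z a ≡ true
        ⇐ h = ∈-all _ Z λ {k} k∈Z → ≡0⇒isZero (vanishes k∈Z)
          where
          below : ∀ i → toℕ i < length Z → evaluate σ a i ≡ 0#
          below = zerosBelow⇒ (length Z) (evaluate σ a) h
          vanishes : ∀ {k} → k ∈ₗ Z → dot a (point k) ≡ 0#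
          vanishes {k} k∈Z with toℕ (index k∈Z) ℕ.<? N
          ... | yes r<N = trans (cong (dot a ∘ point) (sym σi≡k))
                                (below i (subst (ℕ._< length Z) (sym toℕi≡r) (FinP.toℕ<n (index k∈Z))))
            where
            i = Fin.fromℕ< r<N
            toℕi≡r : toℕ i ≡ toℕ (index k∈Z)
            toℕi≡r = FinP.toℕ-fromℕ< r<N
            σi≡k : σ i ≡ k
            σi≡k = lookup-++-index k∈Z _ (trans (FinP.toℕ-inject≤ i N≤length) toℕi≡r)
          ... | no r≮N = trans (dot-congˡ a≗0 (point k)) (dot-zeroˡ (point k))
            where
            a≗0 : a ≗ zeroV
            a≗0 = evaluate-injective σ σ-injective λ i → trans
              (below i (ℕP.<-≤-trans (FinP.toℕ<n i) (ℕP.≤-trans (ℕP.≮⇒≥ r≮N) (ℕP.<⇒≤ (FinP.toℕ<n (index k∈Z))))))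
              (sym (dot-zeroˡ (point (σ i))))

    countPattern-[] : ∀ Z → Unique Z → countPattern Z [] ≡ Q ^ (N ∸ length Z)
    countPattern-[] Z Z-unique = begin
      countV N (λ a → vanishesOn Z a ∧ true)
        ≡⟨ sum-cong-≗ (λ t → cong 𝟙 (trans (∧-identityʳ (vanishesOn Z (decode N t))) (vanishesOn≡zerosBelow (decode N t)))) ⟩
      countV N (zerosBelow (length Z) ∘ evaluate σ)
        ≡⟨ countV-∘-injective _ (zerosBelow-cong (length Z)) (evaluate-cong σ) (evaluate-injective σ σ-injective) ⟩
      countV N (zerosBelow (length Z))                         ≡⟨ countV-zerosBelow N (length Z) ⟩
      Q ^ (N ∸ length Z)                                       ∎
      where
      open ≡-Reasoning
      open Extension Z Z-unique

    countPattern≡ : ∀ Z T → Unique Z → Unique T → Disjoint Z T →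
      ℤ.+ countPattern Z T ≡ vanishAvoidCount Q N (length Z) (length T)
    countPattern≡ Z []      Z-unique T-unique disjoint = cong ℤ.+_ (countPattern-[] Z Z-unique)
    countPattern≡ Z (k ∷ T) Z-unique (k∉T ∷ T-unique) disjoint = begin
      ℤ.+ countPattern Z (k ∷ T)
        ≡⟨ m≡[m+n]-n (ℤ.+ countPattern Z (k ∷ T)) (ℤ.+ countPattern (k ∷ Z) T) ⟩
      ℤ.+ countPattern Z (k ∷ T) ℤ.+ ℤ.+ countPattern (k ∷ Z) T ℤ.- ℤ.+ countPattern (k ∷ Z) T
        ≡⟨ cong (ℤ._- ℤ.+ countPattern (k ∷ Z) T)
             (sym (trans (cong ℤ.+_ (countPattern-∷ Z k T)) (ℤP.pos-+ (countPattern Z (k ∷ T)) (countPattern (k ∷ Z) T)))) ⟩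
      ℤ.+ countPattern Z T ℤ.- ℤ.+ countPattern (k ∷ Z) T
        ≡⟨ cong₂ ℤ._-_ (countPattern≡ Z T Z-unique T-unique (λ (v∈Z , v∈T) → disjoint (v∈Z , there v∈T)))
                        (countPattern≡ (k ∷ Z) T (k∉Z ∷ Z-unique) T-unique disjoint′) ⟩
      vanishAvoidCount Q N (length Z) (length T) ℤ.- vanishAvoidCount Q N (suc (length Z)) (length T) ∎
      where
      open ≡-Reasoning
      k∉Z : All.All (k ≢_) Z
      k∉Z = ¬Any⇒All¬ Z λ k∈Z → disjoint (k∈Z , here refl)
      disjoint′ : Disjoint (k ∷ Z) T
      disjoint′ (here refl , k∈T) = All.lookup k∉T k∈T refl
      disjoint′ (there v∈Z , v∈T) = disjoint (v∈Z , there v∈T)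

    avoidsAll : X → Bool
    avoidsAll = avoids (allFin ℓ)

    countV-avoidsAll : ℤ.+ countV N avoidsAll ≡ vanishAvoidCount Q N 0 ℓ
    countV-avoidsAll = trans (countPattern≡ [] (allFin ℓ) [] (Unique.allFin⁺ ℓ) (λ { (() , _) }))
                             (cong (vanishAvoidCount Q N 0) (length-tabulate {n = ℓ} id))

    avoidsAll⇒ : ∀ a → avoidsAll a ≡ true → ∀ k → dot a (point k) ≢ 0#
    avoidsAll⇒ a h k = isZero-≢0 (not-injective (all-∈ _ h (∈-allFin k)))

    nonzero : X → Bool
    nonzero a = not (zerosBelow N a)

    nonzero⇒ : ∀ a → nonzero a ≡ true → Nonzero a
    nonzero⇒ a h = nonzero-coordinate a λ a≗0 →
      contradiction (trans (sym h) (cong not (⇒zerosBelow N a (λ i _ → a≗0 i)))) λ ()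

    ⇒nonzero : ∀ a → Nonzero a → nonzero a ≡ true
    ⇒nonzero a (k , aₖ≢0) with zerosBelow N a in a≡0
    ... | true  = contradiction (zerosBelow⇒ N a a≡0 k (FinP.toℕ<n k)) aₖ≢0
    ... | false = refl

    countV-nonzero : countV N nonzero ≡ Q ^ N ∸ 1
    countV-nonzero = begin
      countV N nonzero                                         ≡⟨ sym (ℕP.m+n∸m≡n 1 _) ⟩
      1 ℕ.+ countV N nonzero ∸ 1                               ≡⟨ cong (λ z → z ℕ.+ countV N nonzero ∸ 1) zeros ⟩
      countV N (zerosBelow N) ℕ.+ countV N nonzero ∸ 1         ≡⟨ cong (_∸ 1) (count-not (zerosBelow N ∘ decode N)) ⟩
      Q ^ N ∸ 1                                                ∎
      where
      open ≡-Reasoning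
      zeros : 1 ≡ countV N (zerosBelow N)
      zeros = sym (trans (countV-zerosBelow N N) (cong (Q ^_) (ℕP.n∸n≡0 N)))

    countV-nonzero-hyperplanes : ∀ {n} → HasCard (IsSubspaceOfDim K) n → countV N nonzero ≡ n ℕ.* q′
    countV-nonzero-hyperplanes card = CountKernels.countV-kernels card (λ _ V-hyp → V-hyp) nonzero
      (λ a h → let (k , aₖ≢0) = nonzero⇒ a h in (k , aₖ≢0) , Kernel.ker-isHyperplane a k aₖ≢0)
      (λ V a _ _ a≢0 → ⇒nonzero a a≢0)

    countV-avoidsAll-hyperplanes : ∀ {m} → HasCard (λ V → IsSubspaceOfDim K V × Distinguishes P V) m →
      countV N avoidsAll ≡ m ℕ.* q′
    countV-avoidsAll-hyperplanes card = CountKernels.countV-kernels card (λ _ → proj₁) avoidsAll R⇒ ⇒R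
      where
      R⇒ : ∀ a → avoidsAll a ≡ true → Nonzero a × (IsSubspaceOfDim K (ker a) × Distinguishes P (ker a))
      R⇒ a h = (k , aₖ≢0) , Kernel.ker-isHyperplane a k aₖ≢0 ,
               λ j ptⱼ⊆ker → avoidsAll⇒ a h j (isZero-≡0 (ptⱼ⊆ker (point j) (point-∈ j)))
        where
        p₀ = point (σ₀ zero)
        nz = nonzero-coordinate a λ a≗0 → avoidsAll⇒ a h (σ₀ zero) (trans (dot-congˡ a≗0 p₀) (dot-zeroˡ p₀))
        k = proj₁ nz
        aₖ≢0 = proj₂ nz
      ⇒R : ∀ V a → IsSubspaceOfDim K V × Distinguishes P V → V ≐ ker a → Nonzero a → avoidsAll a ≡ true
      ⇒R V a ((V-sub , _) , distinguishes) V≐ker _ = ∈-all _ (allFin ℓ) λ {j} _ →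
        cong not (≢0⇒isZero λ apⱼ≡0 → distinguishes j (point-∈⇒pt-⊆ V-sub j (trans (V≐ker (point j)) (≡0⇒isZero apⱼ≡0))))

  open Alternating q′ using (alternatingTerm; vanishAvoidCount-closed)

  distinguishing-fraction : ∀ K ℓ′ (P : Space.PointSet F (suc K) (suc ℓ′)) → Space.IsArc F (suc K) P → suc K ≤ suc ℓ′ →
    ∀ n m → Space.HasCard F (suc K) (Space.IsSubspaceOfDim F (suc K) K) n →
    Space.HasCard F (suc K) (λ V → Space.IsSubspaceOfDim F (suc K) K V × Space.Distinguishes F (suc K) P V) m →
    (ℤ.+ m) /ℚ n ≡ (ℤ.+ q′ ℤ.* Σℤ (suc K) (alternatingTerm (suc K) ℓ′)) /ℚ (Q ^ suc K ∸ 1)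
  distinguishing-fraction K ℓ′ P arc N≤ℓ n m hyperplanes distinguishing =
    /ℚ-cancel m n (Q ^ N ∸ 1) q′ _ 1≤Q^N∸1
      (trans (sym (countV-nonzero-hyperplanes hyperplanes)) countV-nonzero)
      (trans (cong ℤ.+_ (sym (countV-avoidsAll-hyperplanes distinguishing)))
             (trans countV-avoidsAll (vanishAvoidCount-closed N ℓ′)))
    where
    open Arc K P arc N≤ℓ
    1≤Q^N∸1 : 1 ≤ Q ^ N ∸ 1
    1≤Q^N∸1 = ℕP.∸-monoˡ-≤ 1 (ℕP.≤-trans (ℕ.s≤s 1≤q′)
      (ℕP.≤-trans (ℕP.≤-reflexive (sym (ℕP.*-identityʳ Q))) (ℕP.^-monoʳ-≤ Q (ℕ.s≤s (ℕ.z≤n {K})))))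

open import Data.Integer using (+_)

proposition5p11 :
    (F : FiniteField) (N : ℕ) → N ≥ 3 →
    let open FiniteField F using (q) in
    let open Space F N in
    (ℓ : ℕ) (P : PointSet ℓ) → IsArc P → ℓ ≥ N →
    (n m : ℕ) →
    HasCard (IsSubspaceOfDim (N ∸ 1)) n →
    HasCard (λ V → IsSubspaceOfDim (N ∸ 1) V × Distinguishes P V) m →
    (+ m) /ℚ n ≡
      (+ (q ∸ 1) ℤ.* Σℤ N (λ j → sgn j ℤ.* (+ ((ℓ ∸ 1) C j)) ℤ.* (+ (q ^ (N ∸ j ∸ 1)))))
        /ℚ (q ^ N ∸ 1)
proposition5p11 F (suc K) _ (suc ℓ′) P arc N≤ℓ n m hyperplanes distinguishing
  with q′ , q≡1+q′ ← Fin-inhabited⇒suc (Inverse.from (FiniteField.enum F) (FiniteField.0# F))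
  rewrite q≡1+q′ = FieldCounting.distinguishing-fraction F q≡1+q′ K ℓ′ P arc N≤ℓ n m hyperplanes distinguishing
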